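{- Let $2\le d\le n-1$. Among all double brooms $G$ of order $n$ with diameter $d$, the quantity $\min_{v\in V(G)} J(v)$ is maximized by the balanced double broom $D_{n,d}$, and by no other double broom (up to isomorphism).
   Context: For a connected graph $G=(V,E)$, $H(u,v)$ is the expected number of steps for the simple random walk (moving to a uniformly random neighbor at each step) started at $u$ to reach $v$, with $H(u,u)=0$. The joining time to $v$ is $J(v)=\sum_{u\in V}\deg(u)H(u,v)$. A double broom of order $n$ and diameter $d\ge 2$ is a tree consisting of a path $v_1,\ldots,v_{d-1}$ together with $\ell\ge 1$ leaves adjacent to $v_1$ and $r \geq 1$ leaves adjacent to $v_{d-1}$, where $\ell + r = n-d+1$. The balanced double broom $D_{n,d}$ is the double broom with $\ell=\lfloor (n-d+1)/2\rfloor$ and $r=\lceil (n-d+1)/2\rceil$. -}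

module Defs where

open import Data.Bool using (Bool; true; false; _∧_; _∨_; if_then_else_)
open import Data.Nat using (ℕ; zero; suc; _∸_; _≡ᵇ_; _<ᵇ_; _≤ᵇ_)
  renaming (_+_ to _+ℕ_)
open import Data.Fin using (Fin; toℕ)
import Data.Fin as F
open import Data.Integer using (+_)
open import Data.Rational using (ℚ; 0ℚ; _/_; _+_; _*_; _⊓_)
open import Data.Product using (Σ; _×_)
open import Function.Bundles using (_↔_; Inverse)
open import Relation.Binary.PropositionalEquality using (_≡_; _≢_)

Graph : ℕ → Set
Graph N = Fin N → Fin N → Bool

ℕ→ℚ : ℕ → ℚ
ℕ→ℚ k = + k / 1

sumFin : (N : ℕ) → (Fin N → ℚ) → ℚ
sumFin zero    f = 0ℚ
sumFin (suc N) f = f F.zero + sumFin N (λ i → f (F.suc i))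

countFin : (N : ℕ) → (Fin N → Bool) → ℕ
countFin zero    p = 0
countFin (suc N) p = (if p F.zero then 1 else 0) +ℕ countFin N (λ i → p (F.suc i))

-- minimum over all vertices (the graphs considered have N ≥ 1 vertices;
-- the value for N = 0 is an irrelevant default)
minFin : (N : ℕ) → (Fin N → ℚ) → ℚ
minFin zero          f = 0ℚ
minFin (suc zero)    f = f F.zero
minFin (suc (suc N)) f = f F.zero ⊓ minFin (suc N) (λ i → f (F.suc i))

deg : {N : ℕ} → Graph N → Fin N → ℕ
deg {N} G u = countFin N (G u)

-- H is the hitting-time function of the simple random walk on G:
-- H(v,v) = 0, and for u ≠ v, H(u,v) = 1 + (1/deg u) Σ_{w ~ u} H(w,v)
-- (first-step analysis; written multiplied through by deg u).
-- For a connected graph this linear system has exactly one solution,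
-- namely the expected hitting times.
IsHittingTime : {N : ℕ} → Graph N → (Fin N → Fin N → ℚ) → Set
IsHittingTime {N} G H =
  ((v : Fin N) → H v v ≡ 0ℚ) ×
  ((u v : Fin N) → u ≢ v →
     ℕ→ℚ (deg G u) * H u v
       ≡ ℕ→ℚ (deg G u) + sumFin N (λ w → if G u w then H w v else 0ℚ))

J : {N : ℕ} → Graph N → (Fin N → Fin N → ℚ) → Fin N → ℚ
J {N} G H v = sumFin N (λ u → ℕ→ℚ (deg G u) * H u v)

minJ : {N : ℕ} → Graph N → (Fin N → Fin N → ℚ) → ℚ
minJ {N} G H = minFin N (J G H)

-- Double broom with diameter d (d ≥ 2), ℓ leaves at v₁ and r leaves at v_{d-1}.
-- Vertex numbering (0-based): 0,…,d-2 are the path v₁,…,v_{d-1};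
-- d-1,…,d-2+ℓ are the left leaves (adjacent to v₁ = vertex 0);
-- d-1+ℓ,…,d-2+ℓ+r are the right leaves (adjacent to v_{d-1} = vertex d-2).
broomSize : ℕ → ℕ → ℕ → ℕ
broomSize d ℓ r = (d ∸ 1) +ℕ ℓ +ℕ r

broomEdge : ℕ → ℕ → ℕ → ℕ → Bool
broomEdge d ℓ i j =
     ((suc i ≡ᵇ j) ∧ (j <ᵇ (d ∸ 1)))
  ∨ ((i ≡ᵇ 0) ∧ ((d ∸ 1) ≤ᵇ j) ∧ (j <ᵇ ((d ∸ 1) +ℕ ℓ)))
  ∨ ((i ≡ᵇ (d ∸ 2)) ∧ (((d ∸ 1) +ℕ ℓ) ≤ᵇ j))

doubleBroom : (d ℓ r : ℕ) → Graph (broomSize d ℓ r)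
doubleBroom d ℓ r i j =
  broomEdge d ℓ (toℕ i) (toℕ j) ∨ broomEdge d ℓ (toℕ j) (toℕ i)

Isomorphic : {N M : ℕ} → Graph N → Graph M → Set
Isomorphic {N} {M} G G' =
  Σ (Fin N ↔ Fin M) λ f →
    (i j : Fin N) → G i j ≡ G' (Inverse.to f i) (Inverse.to f j)

{-# OPTIONS --safe #-}
-- For a tree, J(v) = Σₑ (2mₑ + 1)², where mₑ is the number of edges beyond e as seen from v.
-- For the double broom with path vertices 0, …, k this is verified directly: the first-step
-- equations determine hitting times on a connected graph (maximum principle), explicit solutions
-- give J(a) = ℓ + r + Σ_{j<a} (2(ℓ + j) + 1)² + Σ_{j<k-a} (2(r + j) + 1)² at the path vertex a, and
-- J at a leaf is at least J at its neighbour, so min J is the minimum of J(a) over a ≤ k.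
-- Moving a leaf from an end with y + 1 leaves to an end with x < y leaves raises this minimum:
-- for each position on the new broom, the position one edge further from the x end on the old
-- broom costs (2y + 1)² - (2x + 1)² less (if the new position is the y end itself, the same
-- position on the old broom is cheaper as soon as k ≥ 1). Iterating towards the balanced broom gives
-- the inequality, and equality leaves only the star (k = 0), the balanced broom and its mirror image.
module Submission where

open import Defs
open import Data.Nat using (ℕ; _≤_; _∸_; _/_; _+_)
open import Data.Rational using (ℚ) renaming (_≤_ to _≤ℚ_)
open import Data.Product using (_×_)
open import Relation.Binary.PropositionalEquality using (_≡_)

open import Data.Bool using (Bool; true; false; if_then_else_; _∨_; _∧_; _xor_; T)
open import Data.Unit using (tt)
open import Data.Bool.Properties using (∨-comm; ∨-identityʳ; ∨-zeroʳ; ∧-identityʳ; ∧-zeroʳ)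
open import Data.Empty using (⊥; ⊥-elim)
open import Data.Fin as F using (Fin; toℕ)
import Data.Fin.Properties as FP
import Data.Integer as ℤ
import Data.Integer.Properties as ℤP
open import Data.Nat using (zero; suc; pred; _*_; _<_; _⊓_; z≤n; s≤s; z<s; >-nonZero; _≡ᵇ_; _<ᵇ_; _≤ᵇ_; _%_)
open import Data.Nat.DivMod using (m≡m%n+[m/n]*n; m%n<n; m/n≤m; m≥n⇒m/n>0)
open import Data.Nat.Properties
open import Data.Nat.Tactic.RingSolver using (solve-∀)
import Data.Nat.Coprimality as Coprime
open import Data.Product using (Σ; ∃; ∃₂; _,_; proj₁; proj₂)
open import Data.Rational as ℚ using (mkℚ; 0ℚ; _-_) renaming (_<_ to _<ℚ_)
import Data.Rational.Properties as ℚP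
open import Data.Rational.Solver using (module +-*-Solver)
open import Data.Sum using (_⊎_; inj₁; inj₂)
open import Function using (_∘_; const)
open import Function.Bundles using (mk↔ₛ′; mk⇔)
open import Function.Properties.Inverse using (↔-refl)
open import Relation.Binary using (tri<; tri≈; tri>)
open import Relation.Binary.PropositionalEquality
  using (_≢_; refl; sym; trans; cong; cong₂; subst; subst₂; module ≡-Reasoning)
open import Relation.Nullary using (Dec; yes; no)
open import Relation.Nullary.Decidable using (dec-true; dec-false; does-⇔)

sum< : ℕ → (ℕ → ℕ) → ℕ
sum< zero    f = 0
sum< (suc n) f = f 0 + sum< n (λ j → f (suc j))

sum<-cong : ∀ n {f g : ℕ → ℕ} → (∀ j → j < n → f j ≡ g j) → sum< n f ≡ sum< n g
sum<-cong zero    f≗g = refl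
sum<-cong (suc n) f≗g = cong₂ _+_ (f≗g 0 (s≤s z≤n)) (sum<-cong n (λ j j<n → f≗g (suc j) (s≤s j<n)))

sum<-const : ∀ n c → sum< n (const c) ≡ n * c
sum<-const zero    c = refl
sum<-const (suc n) c = cong (c +_) (sum<-const n c)

sum<-zero : ∀ n {f : ℕ → ℕ} → (∀ j → j < n → f j ≡ 0) → sum< n f ≡ 0
sum<-zero n f≗0 = trans (sum<-cong n f≗0) (trans (sum<-const n 0) (*-zeroʳ n))

sum<-++ : ∀ m n f → sum< (m + n) f ≡ sum< m f + sum< n (λ j → f (m + j))
sum<-++ zero    n f = refl
sum<-++ (suc m) n f = trans (cong (f 0 +_) (sum<-++ m n (λ j → f (suc j)))) (sym (+-assoc (f 0) _ _))

sum<-snoc : ∀ n f → sum< (suc n) f ≡ sum< n f + f n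
sum<-snoc zero    f = +-identityʳ (f 0)
sum<-snoc (suc n) f = trans (cong (f 0 +_) (sum<-snoc n (λ j → f (suc j)))) (sym (+-assoc (f 0) _ _))

sum<-+ : ∀ n f g → sum< n (λ j → f j + g j) ≡ sum< n f + sum< n g
sum<-+ zero    f g = refl
sum<-+ (suc n) f g = trans (cong (f 0 + g 0 +_) (sum<-+ n (λ j → f (suc j)) (λ j → g (suc j)))) (swap-middle (f 0) (g 0) _ _)
  where
  swap-middle : ∀ a b c d → (a + b) + (c + d) ≡ (a + c) + (b + d)
  swap-middle = solve-∀

sum<-*ˡ : ∀ n c f → sum< n (λ j → c * f j) ≡ c * sum< n f
sum<-*ˡ zero    c f = sym (*-zeroʳ c)
sum<-*ˡ (suc n) c f = trans (cong (c * f 0 +_) (sum<-*ˡ n c (λ j → f (suc j)))) (sym (*-distribˡ-+ c (f 0) _))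

sum<-if : ∀ n b f → sum< n (λ j → if b then f j else 0) ≡ (if b then sum< n f else 0)
sum<-if n true  f = refl
sum<-if n false f = sum<-zero n (λ _ _ → refl)

sum<-reverse : ∀ n f → sum< n f ≡ sum< n (λ j → f (n ∸ suc j))
sum<-reverse zero    f = refl
sum<-reverse (suc n) f = trans (sum<-snoc n f) (trans (+-comm _ (f n)) (cong (f n +_) (sum<-reverse n f)))

sum<-indicatorˡ : ∀ n p f → sum< n (λ j → if p ≡ᵇ j then f j else 0) ≡ (if p <ᵇ n then f p else 0)
sum<-indicatorˡ zero    p       f = refl
sum<-indicatorˡ (suc n) zero    f = trans (cong (f 0 +_) (sum<-zero n (λ _ _ → refl))) (+-identityʳ _)
sum<-indicatorˡ (suc n) (suc p) f = sum<-indicatorˡ n p (λ j → f (suc j))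

sum<-indicatorʳ : ∀ n p f → sum< n (λ j → if j ≡ᵇ p then f j else 0) ≡ (if p <ᵇ n then f p else 0)
sum<-indicatorʳ zero    p       f = refl
sum<-indicatorʳ (suc n) zero    f = trans (cong (f 0 +_) (sum<-zero n (λ _ _ → refl))) (+-identityʳ _)
sum<-indicatorʳ (suc n) (suc p) f = sum<-indicatorʳ n p (λ j → f (suc j))

term≤sum< : ∀ n p f → p < n → f p ≤ sum< n f
term≤sum< (suc n) zero    f _         = m≤m+n (f 0) _
term≤sum< (suc n) (suc p) f (s≤s p<n) = ≤-trans (term≤sum< n p (λ j → f (suc j)) p<n) (m≤n+m _ (f 0))

sum<-update : ∀ n p f g → p < n → (∀ j → j < n → j ≢ p → f j ≡ g j) →
              sum< n f + g p ≡ sum< n g + f p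
sum<-update (suc n) zero f g _ f≗g =
  trans (cong (λ s → f 0 + s + g 0) (sum<-cong n (λ j j<n → f≗g (suc j) (s≤s j<n) (λ ()))))
        (swap-ends (f 0) _ (g 0))
  where
  swap-ends : ∀ a b c → a + b + c ≡ c + b + a
  swap-ends = solve-∀
sum<-update (suc n) (suc p) f g (s≤s p<n) f≗g = begin
  f 0 + sum< n (λ j → f (suc j)) + g (suc p)   ≡⟨ +-assoc (f 0) _ _ ⟩
  f 0 + (sum< n (λ j → f (suc j)) + g (suc p)) ≡⟨ cong₂ _+_ (f≗g 0 (s≤s z≤n) (λ ())) (sum<-update n p (λ j → f (suc j)) (λ j → g (suc j)) p<n tail≗) ⟩
  g 0 + (sum< n (λ j → g (suc j)) + f (suc p)) ≡⟨ +-assoc (g 0) _ _ ⟨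
  g 0 + sum< n (λ j → g (suc j)) + f (suc p)   ∎
  where
  open ≡-Reasoning
  tail≗ : ∀ j → j < n → j ≢ p → f (suc j) ≡ g (suc j)
  tail≗ j j<n j≢p = f≗g (suc j) (s≤s j<n) (j≢p ∘ suc-injective)

ℕ→ℚ≡mkℚ : ∀ m → ℕ→ℚ m ≡ mkℚ (ℤ.+ m) 0 (Coprime.sym (Coprime.1-coprimeTo m))
ℕ→ℚ≡mkℚ m = ℚP.normalize-coprime (Coprime.sym (Coprime.1-coprimeTo m))

ℕ→ℚ-+ : ∀ m n → ℕ→ℚ (m + n) ≡ ℕ→ℚ m ℚ.+ ℕ→ℚ n
ℕ→ℚ-+ m n rewrite ℕ→ℚ≡mkℚ m | ℕ→ℚ≡mkℚ n =
  ℚP./-cong {ℤ.+ (m + n)} {1} {ℤ.+ m ℤ.* ℤ.+ 1 ℤ.+ ℤ.+ n ℤ.* ℤ.+ 1} {1}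
    (sym (cong₂ ℤ._+_ (ℤP.*-identityʳ (ℤ.+ m)) (ℤP.*-identityʳ (ℤ.+ n)))) refl

ℕ→ℚ-* : ∀ m n → ℕ→ℚ (m * n) ≡ ℕ→ℚ m ℚ.* ℕ→ℚ n
ℕ→ℚ-* m n rewrite ℕ→ℚ≡mkℚ m | ℕ→ℚ≡mkℚ n =
  ℚP./-cong {ℤ.+ (m * n)} {1} {ℤ.+ m ℤ.* ℤ.+ n} {1} (ℤP.pos-* m n) refl

ℕ→ℚ-mono-≤ : ∀ {m n} → m ≤ n → ℕ→ℚ m ≤ℚ ℕ→ℚ n
ℕ→ℚ-mono-≤ {m} {n} m≤n rewrite ℕ→ℚ≡mkℚ m | ℕ→ℚ≡mkℚ n =
  ℚ.*≤* (subst₂ ℤ._≤_ (sym (ℤP.*-identityʳ (ℤ.+ m))) (sym (ℤP.*-identityʳ (ℤ.+ n))) (ℤ.+≤+ m≤n))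

ℕ→ℚ-mono-< : ∀ {m n} → m < n → ℕ→ℚ m <ℚ ℕ→ℚ n
ℕ→ℚ-mono-< {m} {n} m<n rewrite ℕ→ℚ≡mkℚ m | ℕ→ℚ≡mkℚ n =
  ℚ.*<* (subst₂ ℤ._<_ (sym (ℤP.*-identityʳ (ℤ.+ m))) (sym (ℤP.*-identityʳ (ℤ.+ n))) (ℤ.+<+ m<n))

sumFin-cong : ∀ n {f g : Fin n → ℚ} → (∀ w → f w ≡ g w) → sumFin n f ≡ sumFin n g
sumFin-cong zero    f≗g = refl
sumFin-cong (suc n) f≗g = cong₂ ℚ._+_ (f≗g F.zero) (sumFin-cong n (f≗g ∘ F.suc))

sumFin-ℕ→ℚ : ∀ n f → sumFin n (λ w → ℕ→ℚ (f (toℕ w))) ≡ ℕ→ℚ (sum< n f)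
sumFin-ℕ→ℚ zero    f = refl
sumFin-ℕ→ℚ (suc n) f =
  trans (cong (ℕ→ℚ (f 0) ℚ.+_) (sumFin-ℕ→ℚ n (λ j → f (suc j)))) (sym (ℕ→ℚ-+ (f 0) _))

countFin≡sum< : ∀ n (p : ℕ → Bool) → countFin n (λ w → p (toℕ w)) ≡ sum< n (λ j → if p j then 1 else 0)
countFin≡sum< zero    p = refl
countFin≡sum< (suc n) p = cong ((if p 0 then 1 else 0) +_) (countFin≡sum< n (λ j → p (suc j)))

sumFin-difference : ∀ n (f g : Fin n → ℚ) → sumFin n (λ w → f w - g w) ≡ sumFin n f - sumFin n g
sumFin-difference zero    f g = refl
sumFin-difference (suc n) f g =
  trans (cong (f F.zero - g F.zero ℚ.+_) (sumFin-difference n (f ∘ F.suc) (g ∘ F.suc)))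
        (interchange (f F.zero) (g F.zero) (sumFin n (f ∘ F.suc)) (sumFin n (g ∘ F.suc)))
  where
  open +-*-Solver
  interchange : ∀ (a b c d : ℚ) → (a - b) ℚ.+ (c - d) ≡ (a ℚ.+ c) - (b ℚ.+ d)
  interchange = solve 4 (λ a b c d → (a :- b) :+ (c :- d) := (a :+ c) :- (b :+ d)) refl

sumFin-mono-≤ : ∀ n (f g : Fin n → ℚ) → (∀ w → f w ≤ℚ g w) → sumFin n f ≤ℚ sumFin n g
sumFin-mono-≤ zero    f g f≤g = ℚP.≤-refl
sumFin-mono-≤ (suc n) f g f≤g = ℚP.+-mono-≤ (f≤g F.zero) (sumFin-mono-≤ n (f ∘ F.suc) (g ∘ F.suc) (f≤g ∘ F.suc))

sumFin-mono-< : ∀ n (f g : Fin n → ℚ) → (∀ w → f w ≤ℚ g w) → ∀ w → f w <ℚ g w → sumFin n f <ℚ sumFin n g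
sumFin-mono-< (suc n) f g f≤g F.zero    fw<gw =
  ℚP.+-mono-<-≤ fw<gw (sumFin-mono-≤ n (f ∘ F.suc) (g ∘ F.suc) (f≤g ∘ F.suc))
sumFin-mono-< (suc n) f g f≤g (F.suc w) fw<gw =
  ℚP.+-mono-≤-< (f≤g F.zero) (sumFin-mono-< n (f ∘ F.suc) (g ∘ F.suc) (f≤g ∘ F.suc) w fw<gw)

sumFin-indicator : ∀ n (p : Fin n → Bool) c → sumFin n (λ w → if p w then c else 0ℚ) ≡ ℕ→ℚ (countFin n p) ℚ.* c
sumFin-indicator zero    p c = sym (ℚP.*-zeroˡ c)
sumFin-indicator (suc n) p c = begin
  (if p F.zero then c else 0ℚ) ℚ.+ sumFin n (λ w → if p (F.suc w) then c else 0ℚ)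
    ≡⟨ cong₂ ℚ._+_ (head (p F.zero)) (sumFin-indicator n (p ∘ F.suc) c) ⟩
  ℕ→ℚ b ℚ.* c ℚ.+ ℕ→ℚ (countFin n (p ∘ F.suc)) ℚ.* c
    ≡⟨ ℚP.*-distribʳ-+ c (ℕ→ℚ b) _ ⟨
  (ℕ→ℚ b ℚ.+ ℕ→ℚ (countFin n (p ∘ F.suc))) ℚ.* c
    ≡⟨ cong (ℚ._* c) (ℕ→ℚ-+ b _) ⟨
  ℕ→ℚ (b + countFin n (p ∘ F.suc)) ℚ.* c ∎
  where
  open ≡-Reasoning
  b : ℕ
  b = if p F.zero then 1 else 0
  head : ∀ x → (if x then c else 0ℚ) ≡ ℕ→ℚ (if x then 1 else 0) ℚ.* c
  head true  = sym (ℚP.*-identityˡ c)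
  head false = sym (ℚP.*-zeroˡ c)

-- Uniqueness of hitting times on a connected graph

neighbourSum : {n : ℕ} → Graph n → Fin n → (Fin n → ℚ) → ℚ
neighbourSum {n} G u x = sumFin n (λ w → if G u w then x w else 0ℚ)

HittingSystem : {n : ℕ} → Graph n → Fin n → (Fin n → ℚ) → Set
HittingSystem {n} G v x =
  (x v ≡ 0ℚ) × (∀ u → u ≢ v → ℕ→ℚ (deg G u) ℚ.* x u ≡ ℕ→ℚ (deg G u) ℚ.+ neighbourSum G u x)

HarmonicOff : {n : ℕ} → Graph n → Fin n → (Fin n → ℚ) → Set
HarmonicOff {n} G v δ = ∀ u → u ≢ v → ℕ→ℚ (deg G u) ℚ.* δ u ≡ neighbourSum G u δ

-- A certificate of connectedness: parent pointers lead every vertex to the root, decreasing the index.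
record SpanningTree {n : ℕ} (G : Graph n) : Set where
  field
    root       : Fin n
    parent     : Fin n → Fin n
    toParent   : ∀ u → u ≢ root → G u (parent u) ≡ true
    fromParent : ∀ u → u ≢ root → G (parent u) u ≡ true
    parent-<   : ∀ u → u ≢ root → toℕ (parent u) < toℕ u

module _ {n : ℕ} {G : Graph n} (T : SpanningTree G) (P : Fin n → Set)
         (P-step : ∀ u w → G u w ≡ true → P u → P w) where
  open SpanningTree T

  private
    toRoot : ∀ m u → toℕ u < m → P u → P root
    toRoot (suc m) u u<m Pu with u F.≟ root
    ... | yes refl = Pu
    ... | no  u≢r  = toRoot m (parent u) (≤-trans (parent-< u u≢r) (≤-pred u<m)) (P-step u (parent u) (toParent u u≢r) Pu)

    fromRoot : ∀ m w → toℕ w < m → P root → P w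
    fromRoot (suc m) w w<m Pr with w F.≟ root
    ... | yes refl = Pr
    ... | no  w≢r  = P-step (parent w) w (fromParent w w≢r) (fromRoot m (parent w) (≤-trans (parent-< w w≢r) (≤-pred w<m)) Pr)

  edge-closed-spreads : ∀ u w → P u → P w
  edge-closed-spreads u w Pu = fromRoot _ w (n<1+n _) (toRoot _ u (n<1+n _) Pu)

argmax : ∀ n (f : Fin (suc n) → ℚ) → Σ (Fin (suc n)) λ u → ∀ w → f w ≤ℚ f u
argmax zero    f = F.zero , λ { F.zero → ℚP.≤-refl }
argmax (suc n) f with argmax n (f ∘ F.suc)
... | u , fs≤fu with ℚP.≤-total (f F.zero) (f (F.suc u))
...   | inj₁ f0≤fu = F.suc u , λ { F.zero → f0≤fu ; (F.suc w) → fs≤fu w }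
...   | inj₂ fu≤f0 = F.zero  , λ { F.zero → ℚP.≤-refl ; (F.suc w) → ℚP.≤-trans (fs≤fu w) fu≤f0 }

module _ {n : ℕ} {G : Graph (suc n)} (T : SpanningTree G) {v : Fin (suc n)} {δ : Fin (suc n) → ℚ}
         (δv≡0 : δ v ≡ 0ℚ) (harmonic : HarmonicOff G v δ) where

  private
    top : Fin (suc n)
    top = proj₁ (argmax n δ)

    M : ℚ
    M = δ top

    δ≤M : ∀ w → δ w ≤ℚ M
    δ≤M = proj₂ (argmax n δ)

    -- Off v, δ is the average of its neighbours, so a neighbour below M would pull δ u below M.
    maximum-spreads : ∀ u w → u ≢ v → δ u ≡ M → G u w ≡ true → δ w ≡ M
    maximum-spreads u w u≢v δu≡M uw with ℚP.<-cmp (δ w) M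
    ... | tri≈ _ δw≡M _ = δw≡M
    ... | tri> _ _ M<δw = ⊥-elim (ℚP.<-irrefl refl (ℚP.<-≤-trans M<δw (δ≤M w)))
    ... | tri< δw<M _ _ = ⊥-elim (ℚP.<-irrefl refl (subst₂ _<ℚ_ lhs rhs sum<sum))
      where
      masked≤ : ∀ x b → δ x ≤ℚ M → (if b then δ x else 0ℚ) ≤ℚ (if b then M else 0ℚ)
      masked≤ x true  δx≤M = δx≤M
      masked≤ x false _    = ℚP.≤-refl
      masked< : ∀ b → b ≡ true → (if b then δ w else 0ℚ) <ℚ (if b then M else 0ℚ)
      masked< true _ = δw<M
      sum<sum : neighbourSum G u δ <ℚ sumFin (suc n) (λ x → if G u x then M else 0ℚ)
      sum<sum = sumFin-mono-< (suc n) _ _ (λ x → masked≤ x (G u x) (δ≤M x)) w (masked< (G u w) uw)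
      lhs : neighbourSum G u δ ≡ ℕ→ℚ (deg G u) ℚ.* M
      lhs = trans (sym (harmonic u u≢v)) (cong (ℕ→ℚ (deg G u) ℚ.*_) δu≡M)
      rhs : sumFin (suc n) (λ x → if G u x then M else 0ℚ) ≡ ℕ→ℚ (deg G u) ℚ.* M
      rhs = sumFin-indicator (suc n) (G u) M

    -- The second disjunct lets the predicate pass through v, where δ need not be harmonic.
    AtMaximum : Fin (suc n) → Set
    AtMaximum w = (δ w ≡ M) ⊎ (δ v ≡ M)

    atMaximum-step : ∀ u w → G u w ≡ true → AtMaximum u → AtMaximum w
    atMaximum-step u w uw (inj₂ δv≡M) = inj₂ δv≡M
    atMaximum-step u w uw (inj₁ δu≡M) with u F.≟ v
    ... | yes refl = inj₂ δu≡M
    ... | no  u≢v  = inj₁ (maximum-spreads u w u≢v δu≡M uw)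

    M≡0 : AtMaximum v → M ≡ 0ℚ
    M≡0 (inj₁ δv≡M) = trans (sym δv≡M) δv≡0
    M≡0 (inj₂ δv≡M) = trans (sym δv≡M) δv≡0

  maximum-principle : ∀ u → δ u ≤ℚ 0ℚ
  maximum-principle u = ℚP.≤-trans (δ≤M u)
    (ℚP.≤-reflexive (M≡0 (edge-closed-spreads T AtMaximum atMaximum-step top v (inj₁ refl))))

hitting-difference-harmonic : ∀ {n} (G : Graph n) {v x y} → HittingSystem G v x → HittingSystem G v y →
                              HarmonicOff G v (λ w → x w - y w)
hitting-difference-harmonic {n} G {v} {x} {y} (_ , x-eq) (_ , y-eq) u u≢v = begin
  d ℚ.* (x u - y u)                                           ≡⟨ distrib d (x u) (y u) ⟩
  d ℚ.* x u - d ℚ.* y u                                       ≡⟨ cong₂ _-_ (x-eq u u≢v) (y-eq u u≢v) ⟩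
  (d ℚ.+ neighbourSum G u x) - (d ℚ.+ neighbourSum G u y)     ≡⟨ cancel d _ _ ⟩
  neighbourSum G u x - neighbourSum G u y                     ≡⟨ sumFin-difference n _ _ ⟨
  sumFin n (λ w → (if G u w then x w else 0ℚ) - (if G u w then y w else 0ℚ))
    ≡⟨ sumFin-cong n (λ w → masked-difference (G u w) (x w) (y w)) ⟩
  neighbourSum G u (λ w → x w - y w)                          ∎
  where
  open ≡-Reasoning
  open +-*-Solver
  d : ℚ
  d = ℕ→ℚ (deg G u)
  distrib : ∀ (d a b : ℚ) → d ℚ.* (a - b) ≡ d ℚ.* a - d ℚ.* b
  distrib = solve 3 (λ d a b → d :* (a :- b) := d :* a :- d :* b) refl
  cancel : ∀ (d a b : ℚ) → (d ℚ.+ a) - (d ℚ.+ b) ≡ a - b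
  cancel = solve 3 (λ d a b → (d :+ a) :- (d :+ b) := a :- b) refl
  masked-difference : ∀ c (p q : ℚ) → (if c then p else 0ℚ) - (if c then q else 0ℚ) ≡ (if c then p - q else 0ℚ)
  masked-difference true  p q = refl
  masked-difference false p q = ℚP.+-inverseʳ 0ℚ

hitting-unique : ∀ {n} {G : Graph (suc n)} → SpanningTree G → ∀ {v x y} →
                 HittingSystem G v x → HittingSystem G v y → ∀ u → x u ≡ y u
hitting-unique {G = G} T {v} {x} {y} sx sy u = ℚP.≤-antisym (below sx sy) (below sy sx)
  where
  below : ∀ {x y} → HittingSystem G v x → HittingSystem G v y → x u ≤ℚ y u
  below {x} {y} sx sy = begin
    x u                   ≡⟨ split (x u) (y u) ⟩
    (x u - y u) ℚ.+ y u   ≤⟨ ℚP.+-monoˡ-≤ (y u) x-y≤0 ⟩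
    0ℚ ℚ.+ y u            ≡⟨ ℚP.+-identityˡ (y u) ⟩
    y u                   ∎
    where
    open ℚP.≤-Reasoning
    open +-*-Solver
    split : ∀ (a b : ℚ) → a ≡ (a - b) ℚ.+ b
    split = solve 2 (λ a b → a := (a :- b) :+ b) refl
    x-y≤0 : x u - y u ≤ℚ 0ℚ
    x-y≤0 = maximum-principle T (trans (cong₂ _-_ (proj₁ sx) (proj₁ sy)) (ℚP.+-inverseʳ 0ℚ))
                                (hitting-difference-harmonic G sx sy) u

≡ᵇ-true : ∀ {m n} → m ≡ n → (m ≡ᵇ n) ≡ true
≡ᵇ-true {m} {n} = dec-true (m ≟ n)

≡ᵇ-false : ∀ {m n} → m ≢ n → (m ≡ᵇ n) ≡ false
≡ᵇ-false {m} {n} = dec-false (m ≟ n)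

<ᵇ-true : ∀ {m n} → m < n → (m <ᵇ n) ≡ true
<ᵇ-true {m} {n} = dec-true (m <? n)

<ᵇ-false : ∀ {m n} → n ≤ m → (m <ᵇ n) ≡ false
<ᵇ-false {m} {n} n≤m = dec-false (m <? n) (≤⇒≯ n≤m)

≤ᵇ-true : ∀ {m n} → m ≤ n → (m ≤ᵇ n) ≡ true
≤ᵇ-true {m} {n} = dec-true (m ≤? n)

≤ᵇ-false : ∀ {m n} → n < m → (m ≤ᵇ n) ≡ false
≤ᵇ-false {m} {n} n<m = dec-false (m ≤? n) (<⇒≱ n<m)

if-∨ : ∀ x y (v : ℕ) → (x ≡ true → y ≡ true → ⊥) →
       (if x ∨ y then v else 0) ≡ (if x then v else 0) + (if y then v else 0)
if-∨ true  true  v excl = ⊥-elim (excl refl refl)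
if-∨ true  false v excl = sym (+-identityʳ v)
if-∨ false y     v excl = refl

-- The double broom of diameter k + 2: path vertices 0, …, k, left leaves k + 1 + a (a < ℓ),
-- right leaves k + 1 + ℓ + b (b < r).
module Broom (k ℓ r : ℕ) where

  arc : ℕ → ℕ → Bool
  arc = broomEdge (suc (suc k)) ℓ

  adj : ℕ → ℕ → Bool
  adj i j = arc i j ∨ arc j i

  order : ℕ
  order = suc k + ℓ + r

  data Vertex (u : ℕ) : Set where
    path  : u ≤ k → Vertex u
    left  : ∀ a → a < ℓ → u ≡ suc k + a → Vertex u
    right : ∀ b → b < r → u ≡ suc k + ℓ + b → Vertex u

  vertex : ∀ u → u < order → Vertex u
  vertex u u<order with u ≤? k | u <? suc k + ℓ
  ... | yes u≤k | _         = path u≤k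
  ... | no  u≰k | yes u<k+ℓ = left (u ∸ suc k) (subst (u ∸ suc k <_) (m+n∸m≡n (suc k) ℓ) (∸-monoˡ-< u<k+ℓ (≰⇒> u≰k)))
                                   (sym (m+[n∸m]≡n (≰⇒> u≰k)))
  ... | no  _   | no  u≮k+ℓ = right (u ∸ (suc k + ℓ)) (subst (u ∸ (suc k + ℓ) <_) (m+n∸m≡n (suc k + ℓ) r) (∸-monoˡ-< u<order (≮⇒≥ u≮k+ℓ)))
                                    (sym (m+[n∸m]≡n (≮⇒≥ u≮k+ℓ)))

  left<order : ∀ {a} → a < ℓ → suc k + a < order
  left<order a<ℓ = ≤-trans (+-monoʳ-< (suc k) a<ℓ) (m≤m+n (suc k + ℓ) r)

  right<order : ∀ {b} → b < r → suc k + ℓ + b < order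
  right<order b<r = +-monoʳ-< (suc k + ℓ) b<r

  path<order : ∀ {i} → i ≤ k → i < order
  path<order i≤k = s≤s (≤-trans i≤k (≤-trans (m≤m+n k ℓ) (m≤m+n (k + ℓ) r)))

  k<left : ∀ a → k < suc k + a
  k<left a = s≤s (m≤m+n k a)

  k<right : ∀ b → k < suc k + ℓ + b
  k<right b = ≤-trans (k<left ℓ) (m≤m+n _ b)

  arc-path-path : ∀ i j → i ≤ k → j ≤ k → arc i j ≡ (suc i ≡ᵇ j)
  arc-path-path i j i≤k j≤k
    rewrite <ᵇ-true (s≤s j≤k) | <ᵇ-false {k} {j} j≤k | <ᵇ-false {k + ℓ} {j} (≤-trans j≤k (m≤m+n k ℓ))
          | ∧-identityʳ (suc i ≡ᵇ j) | ∧-zeroʳ (i ≡ᵇ 0) | ∧-zeroʳ (i ≡ᵇ k) = ∨-identityʳ _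

  arc-path-left : ∀ i a → a < ℓ → arc i (suc k + a) ≡ (i ≡ᵇ 0)
  arc-path-left i a a<ℓ
    rewrite <ᵇ-false {suc k + a} {suc k} (m≤m+n (suc k) a) | <ᵇ-true (k<left a)
          | <ᵇ-true (+-monoʳ-< (suc k) a<ℓ) | <ᵇ-false {k + ℓ} {suc (k + a)} (subst (_≤ k + ℓ) (+-suc k a) (+-monoʳ-≤ k a<ℓ))
          | ∧-zeroʳ (i ≡ᵇ k + a) | ∧-identityʳ (i ≡ᵇ 0) | ∧-zeroʳ (i ≡ᵇ k) = ∨-identityʳ _

  arc-path-right : ∀ i b → arc i (suc k + ℓ + b) ≡ (i ≡ᵇ k)
  arc-path-right i b
    rewrite <ᵇ-false {suc k + ℓ + b} {suc k} (≤-trans (m≤m+n (suc k) ℓ) (m≤m+n _ b))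
          | <ᵇ-false {suc k + ℓ + b} {suc k + ℓ} (m≤m+n _ b) | <ᵇ-true (s≤s (m≤m+n (k + ℓ) b))
          | ∧-zeroʳ (k <ᵇ suc k + ℓ + b) | ∧-zeroʳ (i ≡ᵇ 0) | ∧-identityʳ (i ≡ᵇ k) | ∧-zeroʳ (i ≡ᵇ k + ℓ + b) = refl

  arc-from-leaf : ∀ x j → k < x → arc x j ≡ false
  arc-from-leaf x j k<x rewrite ≡ᵇ-false {x} {0} (>⇒≢ (≤-<-trans z≤n k<x)) | ≡ᵇ-false {x} {k} (>⇒≢ k<x) with j ≤? k
  ... | yes j≤k rewrite ≡ᵇ-false {suc x} {j} (>⇒≢ (s≤s (≤-trans j≤k (<⇒≤ k<x)))) = refl
  ... | no  j≰k rewrite <ᵇ-false {j} {suc k} (≰⇒> j≰k) | ∧-zeroʳ (suc x ≡ᵇ j) = refl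

  adj-path-path : ∀ i j → i ≤ k → j ≤ k → adj i j ≡ ((suc i ≡ᵇ j) ∨ (suc j ≡ᵇ i))
  adj-path-path i j i≤k j≤k = cong₂ _∨_ (arc-path-path i j i≤k j≤k) (arc-path-path j i j≤k i≤k)

  adj-path-left : ∀ i a → a < ℓ → adj i (suc k + a) ≡ (i ≡ᵇ 0)
  adj-path-left i a a<ℓ rewrite arc-path-left i a a<ℓ | arc-from-leaf (suc k + a) i (k<left a) = ∨-identityʳ _

  adj-path-right : ∀ i b → adj i (suc k + ℓ + b) ≡ (i ≡ᵇ k)
  adj-path-right i b rewrite arc-path-right i b | arc-from-leaf (suc k + ℓ + b) i (k<right b) = ∨-identityʳ _

  adj-left-path : ∀ a j → a < ℓ → adj (suc k + a) j ≡ (j ≡ᵇ 0)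
  adj-left-path a j a<ℓ rewrite arc-from-leaf (suc k + a) j (k<left a) = arc-path-left j a a<ℓ

  adj-right-path : ∀ b j → adj (suc k + ℓ + b) j ≡ (j ≡ᵇ k)
  adj-right-path b j rewrite arc-from-leaf (suc k + ℓ + b) j (k<right b) = arc-path-right j b

  adj-leaf-leaf : ∀ x y → k < x → k < y → adj x y ≡ false
  adj-leaf-leaf x y k<x k<y rewrite arc-from-leaf x y k<x | arc-from-leaf y x k<y = refl

  adj-sym : ∀ i j → adj i j ≡ adj j i
  adj-sym i j = ∨-comm (arc i j) (arc j i)

  neighbourTerm : ℕ → (ℕ → ℕ) → ℕ → ℕ
  neighbourTerm u h j = if adj u j then h j else 0

  neighbourSumℕ : ℕ → (ℕ → ℕ) → ℕ
  neighbourSumℕ u h = sum< order (neighbourTerm u h)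

  degreeℕ : ℕ → ℕ
  degreeℕ u = neighbourSumℕ u (const 1)

  leftSum : (ℕ → ℕ) → ℕ
  leftSum h = sum< ℓ (λ a → h (suc k + a))

  rightSum : (ℕ → ℕ) → ℕ
  rightSum h = sum< r (λ b → h (suc k + ℓ + b))

  sum<-order : ∀ f → sum< order f ≡ sum< (suc k) f + leftSum f + rightSum f
  sum<-order f = trans (sum<-++ (suc k + ℓ) r f) (cong (_+ rightSum f) (sum<-++ (suc k) ℓ f))

  private
    leaf-blocks-vanish : ∀ x h → k < x → leftSum (neighbourTerm x h) + rightSum (neighbourTerm x h) ≡ 0
    leaf-blocks-vanish x h k<x = cong₂ _+_
      (sum<-zero ℓ (λ a _ → cong (λ e → if e then _ else 0) (adj-leaf-leaf x _ k<x (k<left a))))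
      (sum<-zero r (λ b _ → cong (λ e → if e then _ else 0) (adj-leaf-leaf x _ k<x (k<right b))))

    leaf-neighbourSum : ∀ x p h → k < x → p ≤ k → (∀ j → j ≤ k → adj x j ≡ (j ≡ᵇ p)) → neighbourSumℕ x h ≡ h p
    leaf-neighbourSum x p h k<x p≤k adj-x = begin
      neighbourSumℕ x h
        ≡⟨ sum<-order (neighbourTerm x h) ⟩
      sum< (suc k) (neighbourTerm x h) + leftSum (neighbourTerm x h) + rightSum (neighbourTerm x h)
        ≡⟨ +-assoc (sum< (suc k) (neighbourTerm x h)) _ _ ⟩
      sum< (suc k) (neighbourTerm x h) + (leftSum (neighbourTerm x h) + rightSum (neighbourTerm x h))
        ≡⟨ cong₂ _+_ (sum<-cong (suc k) (λ j j≤k → cong (λ e → if e then h j else 0) (adj-x j (≤-pred j≤k))))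
                     (leaf-blocks-vanish x h k<x) ⟩
      sum< (suc k) (λ j → if j ≡ᵇ p then h j else 0) + 0
        ≡⟨ +-identityʳ _ ⟩
      sum< (suc k) (λ j → if j ≡ᵇ p then h j else 0)
        ≡⟨ sum<-indicatorʳ (suc k) p h ⟩
      (if p <ᵇ suc k then h p else 0)
        ≡⟨ cong (λ e → if e then h p else 0) (<ᵇ-true (s≤s p≤k)) ⟩
      h p ∎
      where open ≡-Reasoning

  neighbourSum-left : ∀ a h → a < ℓ → neighbourSumℕ (suc k + a) h ≡ h 0
  neighbourSum-left a h a<ℓ = leaf-neighbourSum (suc k + a) 0 h (k<left a) z≤n (λ j _ → adj-left-path a j a<ℓ)

  neighbourSum-right : ∀ b h → neighbourSumℕ (suc k + ℓ + b) h ≡ h k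
  neighbourSum-right b h = leaf-neighbourSum (suc k + ℓ + b) k h (k<right b) ≤-refl (λ j _ → adj-right-path b j)

  predTerm : ℕ → (ℕ → ℕ) → ℕ
  predTerm zero    h = 0
  predTerm (suc i) h = h i

  private
    predecessor-sum : ∀ i h → i ≤ k → sum< (suc k) (λ j → if suc j ≡ᵇ i then h j else 0) ≡ predTerm i h
    predecessor-sum zero    h _   = sum<-zero (suc k) (λ _ _ → refl)
    predecessor-sum (suc i) h i<k = trans (sum<-indicatorʳ (suc k) i h)
                                          (cong (λ e → if e then h i else 0) (<ᵇ-true (≤-trans i<k (n≤1+n k))))

    path-block : ∀ i h → i ≤ k → sum< (suc k) (neighbourTerm i h) ≡ (if suc i <ᵇ suc k then h (suc i) else 0) + predTerm i h
    path-block i h i≤k = begin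
      sum< (suc k) (neighbourTerm i h)
        ≡⟨ sum<-cong (suc k) (λ j j≤k → trans (cong (λ e → if e then h j else 0) (adj-path-path i j i≤k (≤-pred j≤k)))
                                              (if-∨ (suc i ≡ᵇ j) (suc j ≡ᵇ i) (h j) (not-both j))) ⟩
      sum< (suc k) (λ j → (if suc i ≡ᵇ j then h j else 0) + (if suc j ≡ᵇ i then h j else 0))
        ≡⟨ sum<-+ (suc k) (λ j → if suc i ≡ᵇ j then h j else 0) (λ j → if suc j ≡ᵇ i then h j else 0) ⟩
      sum< (suc k) (λ j → if suc i ≡ᵇ j then h j else 0) + sum< (suc k) (λ j → if suc j ≡ᵇ i then h j else 0)
        ≡⟨ cong₂ _+_ (sum<-indicatorˡ (suc k) (suc i) h) (predecessor-sum i h i≤k) ⟩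
      (if suc i <ᵇ suc k then h (suc i) else 0) + predTerm i h ∎
      where
      open ≡-Reasoning
      not-both : ∀ j → (suc i ≡ᵇ j) ≡ true → (suc j ≡ᵇ i) ≡ true → ⊥
      not-both j i+1≡j j+1≡i with ≡ᵇ⇒≡ (suc i) j (subst T (sym i+1≡j) tt) | ≡ᵇ⇒≡ (suc j) i (subst T (sym j+1≡i) tt)
      ... | refl | j+1≡i = <-irrefl (sym j+1≡i) (≤-trans (n<1+n i) (n≤1+n (suc i)))

  neighbourSum-path : ∀ i h → i ≤ k →
    neighbourSumℕ i h ≡ (if suc i <ᵇ suc k then h (suc i) else 0) + predTerm i h
                        + (if i ≡ᵇ 0 then leftSum h else 0) + (if i ≡ᵇ k then rightSum h else 0)
  neighbourSum-path i h i≤k = trans (sum<-order (neighbourTerm i h)) (cong₂ _+_ (cong₂ _+_ (path-block i h i≤k) left-block) right-block)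
    where
    left-block : leftSum (neighbourTerm i h) ≡ (if i ≡ᵇ 0 then leftSum h else 0)
    left-block = trans (sum<-cong ℓ (λ a a<ℓ → cong (λ e → if e then _ else 0) (adj-path-left i a a<ℓ)))
                       (sum<-if ℓ (i ≡ᵇ 0) (λ a → h (suc k + a)))
    right-block : rightSum (neighbourTerm i h) ≡ (if i ≡ᵇ k then rightSum h else 0)
    right-block = trans (sum<-cong r (λ b _ → cong (λ e → if e then _ else 0) (adj-path-right i b)))
                        (sum<-if r (i ≡ᵇ k) (λ b → h (suc k + ℓ + b)))

  neighbourSum-first : ∀ h → 0 < k → neighbourSumℕ 0 h ≡ h 1 + leftSum h
  neighbourSum-first h 0<k rewrite neighbourSum-path 0 h z≤n | <ᵇ-true {1} {suc k} (s≤s 0<k) | ≡ᵇ-false {0} {k} (<⇒≢ 0<k)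
    = trans (+-identityʳ _) (cong (_+ leftSum h) (+-identityʳ _))

  neighbourSum-centre : ∀ h → k ≡ 0 → neighbourSumℕ 0 h ≡ leftSum h + rightSum h
  neighbourSum-centre h refl rewrite neighbourSum-path 0 h z≤n = refl

  neighbourSum-inner : ∀ i h → suc i < k → neighbourSumℕ (suc i) h ≡ h (suc (suc i)) + h i
  neighbourSum-inner i h i+1<k rewrite neighbourSum-path (suc i) h (<⇒≤ i+1<k) | <ᵇ-true (s≤s i+1<k) | ≡ᵇ-false (<⇒≢ i+1<k)
    = trans (+-identityʳ _) (+-identityʳ _)

  neighbourSum-last : ∀ h → 0 < k → neighbourSumℕ k h ≡ h (pred k) + rightSum h
  neighbourSum-last h 0<k rewrite neighbourSum-path k h ≤-refl | <ᵇ-false {suc k} {suc k} ≤-refl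
                               | ≡ᵇ-false {k} {0} (>⇒≢ 0<k) | ≡ᵇ-true {k} {k} refl
    = cong (_+ rightSum h) (trans (+-identityʳ _) (predTerm-pos 0<k))
    where
    predTerm-pos : ∀ {i} → 0 < i → predTerm i h ≡ h (pred i)
    predTerm-pos {suc i} _ = refl

  private
    leftSum-one : leftSum (const 1) ≡ ℓ
    leftSum-one = trans (sum<-const ℓ 1) (*-identityʳ ℓ)

    rightSum-one : rightSum (const 1) ≡ r
    rightSum-one = trans (sum<-const r 1) (*-identityʳ r)

  degree-left : ∀ a → a < ℓ → degreeℕ (suc k + a) ≡ 1
  degree-left a = neighbourSum-left a (const 1)

  degree-right : ∀ b → degreeℕ (suc k + ℓ + b) ≡ 1
  degree-right b = neighbourSum-right b (const 1)

  degree-first : 0 < k → degreeℕ 0 ≡ suc ℓ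
  degree-first 0<k = trans (neighbourSum-first (const 1) 0<k) (cong suc leftSum-one)

  degree-centre : k ≡ 0 → degreeℕ 0 ≡ ℓ + r
  degree-centre k≡0 = trans (neighbourSum-centre (const 1) k≡0)
                            (cong₂ _+_ leftSum-one rightSum-one)

  degree-inner : ∀ i → suc i < k → degreeℕ (suc i) ≡ 2
  degree-inner i = neighbourSum-inner i (const 1)

  degree-last : 0 < k → degreeℕ k ≡ suc r
  degree-last 0<k = trans (neighbourSum-last (const 1) 0<k) (cong suc rightSum-one)

-- Hitting times on a path with leaves at its ends

-- armHit c i t = t (2c + 2i + t) is the expected time to walk t steps along the path away from an end
-- carrying c leaves, starting at distance i from that end; crossing its j-th edge takes crossTime c j.
armHit : ℕ → ℕ → ℕ → ℕ
armHit c i t = t * (c + c + i + i + t)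

crossTime : ℕ → ℕ → ℕ
crossTime c j = suc (c + c + j + j)

crossSquares : ℕ → ℕ → ℕ
crossSquares c zero    = 0
crossSquares c (suc a) = crossSquares c a + crossTime c a * crossTime c a

-- The ring solver does not unfold definitions, hence the restated identities named unfolded.
armHit-suc : ∀ c i t → armHit c i (suc t) ≡ armHit c i t + crossTime c (i + t)
armHit-suc = unfolded
  where
  unfolded : ∀ c i t → suc t * (c + c + i + i + suc t) ≡ t * (c + c + i + i + t) + suc (c + c + (i + t) + (i + t))
  unfolded = solve-∀

armHit-one : ∀ c i → armHit c i 1 ≡ crossTime c i
armHit-one = unfolded
  where
  unfolded : ∀ c i → 1 * (c + c + i + i + 1) ≡ suc (c + c + i + i)
  unfolded = solve-∀

armHit-end : ∀ c t → suc c * armHit c 0 (suc t) ≡ suc c + (armHit c 1 t + c * suc (armHit c 0 (suc t)))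
armHit-end = unfolded
  where
  unfolded : ∀ c t → suc c * (suc t * (c + c + 0 + 0 + suc t))
                     ≡ suc c + (t * (c + c + 1 + 1 + t) + c * suc (suc t * (c + c + 0 + 0 + suc t)))
  unfolded = solve-∀

armHit-inner : ∀ c i t → 2 * armHit c (suc i) (suc t) ≡ 2 + (armHit c (suc (suc i)) t + armHit c i (suc (suc t)))
armHit-inner = unfolded
  where
  unfolded : ∀ c i t → 2 * (suc t * (c + c + suc i + suc i + suc t))
                       ≡ 2 + (t * (c + c + suc (suc i) + suc (suc i) + t) + suc (suc t) * (c + c + i + i + suc (suc t)))
  unfolded = solve-∀

armDegree : ℕ → ℕ → ℕ
armDegree c i = if i ≡ᵇ 0 then suc c else 2

armPathJoin : ℕ → ℕ → ℕ
armPathJoin c a = sum< a (λ i → armDegree c i * armHit c i (a ∸ i))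

armJoin : ℕ → ℕ → ℕ
armJoin c a = armPathJoin c a + c * suc (armHit c 0 a)

armDegree-sum : ∀ c a → sum< (suc a) (armDegree c) + c ≡ crossTime c a
armDegree-sum c a = trans (cong (λ s → suc c + s + c) (sum<-const a 2)) (rearrange c a)
  where
  rearrange : ∀ c a → suc c + a * 2 + c ≡ suc (c + c + a + a)
  rearrange = solve-∀

armJoin-suc : ∀ c a → armJoin c (suc a) ≡ armJoin c a + crossTime c a * crossTime c a
armJoin-suc c a = begin
  sum< (suc a) (λ i → W i * armHit c i (suc a ∸ i)) + c * suc (armHit c 0 (suc a))
    ≡⟨ cong₂ _+_ path-part leaf-part ⟩
  (X + D * sum< a W + W a * D) + (c * suc (armHit c 0 a) + c * D)
    ≡⟨ regroup X (sum< a W) (W a) (armHit c 0 a) c D ⟩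
  (X + c * suc (armHit c 0 a)) + D * (sum< a W + W a + c)
    ≡⟨ cong (λ s → armJoin c a + D * (s + c)) (sym (sum<-snoc a W)) ⟩
  armJoin c a + D * (sum< (suc a) W + c)
    ≡⟨ cong (λ s → armJoin c a + D * s) (armDegree-sum c a) ⟩
  armJoin c a + D * D ∎
  where
  open ≡-Reasoning
  W : ℕ → ℕ
  W = armDegree c
  D : ℕ
  D = crossTime c a
  X : ℕ
  X = sum< a (λ i → W i * armHit c i (a ∸ i))
  regroup : ∀ X Y w P c D → (X + D * Y + w * D) + (c * suc P + c * D) ≡ (X + c * suc P) + D * (Y + w + c)
  regroup = solve-∀
  one-more-step : ∀ i → i < a → W i * armHit c i (suc a ∸ i) ≡ W i * armHit c i (a ∸ i) + D * W i
  one-more-step i i<a = begin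
    W i * armHit c i (suc a ∸ i)              ≡⟨ cong (λ t → W i * armHit c i t) (+-∸-assoc 1 (<⇒≤ i<a)) ⟩
    W i * armHit c i (suc (a ∸ i))            ≡⟨ cong (W i *_) (armHit-suc c i (a ∸ i)) ⟩
    W i * (armHit c i (a ∸ i) + crossTime c (i + (a ∸ i)))
      ≡⟨ cong (λ j → W i * (armHit c i (a ∸ i) + crossTime c j)) (m+[n∸m]≡n (<⇒≤ i<a)) ⟩
    W i * (armHit c i (a ∸ i) + D)            ≡⟨ *-distribˡ-+ (W i) _ D ⟩
    W i * armHit c i (a ∸ i) + W i * D        ≡⟨ cong (W i * armHit c i (a ∸ i) +_) (*-comm (W i) D) ⟩
    W i * armHit c i (a ∸ i) + D * W i        ∎
  path-part : sum< (suc a) (λ i → W i * armHit c i (suc a ∸ i)) ≡ X + D * sum< a W + W a * D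
  path-part = begin
    sum< (suc a) (λ i → W i * armHit c i (suc a ∸ i))
      ≡⟨ sum<-snoc a _ ⟩
    sum< a (λ i → W i * armHit c i (suc a ∸ i)) + W a * armHit c a (suc a ∸ a)
      ≡⟨ cong₂ _+_ (sum<-cong a one-more-step) (cong (W a *_) (trans (cong (armHit c a) (m+n∸n≡m 1 a)) (armHit-one c a))) ⟩
    sum< a (λ i → W i * armHit c i (a ∸ i) + D * W i) + W a * D
      ≡⟨ cong (_+ W a * D) (trans (sum<-+ a _ _) (cong (X +_) (sum<-*ˡ a D W))) ⟩
    X + D * sum< a W + W a * D ∎
  leaf-part : c * suc (armHit c 0 (suc a)) ≡ c * suc (armHit c 0 a) + c * D
  leaf-part = trans (cong (λ h → c * suc h) (armHit-suc c 0 a)) (*-distribˡ-+ c (suc (armHit c 0 a)) D)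

armJoin≡ : ∀ c a → armJoin c a ≡ c + crossSquares c a
armJoin≡ c zero    = trans (*-identityʳ c) (sym (+-identityʳ c))
armJoin≡ c (suc a) = trans (armJoin-suc c a) (trans (cong (_+ crossTime c a * crossTime c a) (armJoin≡ c a))
                                                     (+-assoc c (crossSquares c a) _))

module BroomHitting (k ℓ r : ℕ) where
  open Broom k ℓ r

  FirstStep : (ℕ → ℕ) → ℕ → Set
  FirstStep h u = degreeℕ u * h u ≡ degreeℕ u + neighbourSumℕ u h

  hitPath : ℕ → ℕ → ℕ
  hitPath a i = if i ≤ᵇ a then armHit ℓ i (a ∸ i) else armHit r (k ∸ i) (i ∸ a)

  hit : ℕ → ℕ → ℕ
  hit a u = if u ≤ᵇ k then hitPath a u else if u <ᵇ suc k + ℓ then suc (hitPath a 0) else suc (hitPath a k)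

  hitPath-leftOf : ∀ a i t → i + t ≡ a → hitPath a i ≡ armHit ℓ i t
  hitPath-leftOf a i t refl rewrite ≤ᵇ-true (m≤m+n i t) | m+n∸m≡n i t = refl

  hitPath-rightOf : ∀ a i s m → a + s ≡ i → i + m ≡ k → hitPath a i ≡ armHit r m s
  hitPath-rightOf a i zero    m a+0≡i _ = hitPath-leftOf a i 0 (trans (+-identityʳ i) (trans (sym a+0≡i) (+-identityʳ a)))
  hitPath-rightOf a i (suc s) m refl refl rewrite ≤ᵇ-false {a + suc s} {a} (≤-trans (s≤s (m≤m+n a s)) (≤-reflexive (sym (+-suc a s))))
    | m+n∸m≡n (a + suc s) m | m+n∸m≡n a (suc s) = refl

  hit-path : ∀ a i → i ≤ k → hit a i ≡ hitPath a i
  hit-path a i i≤k rewrite ≤ᵇ-true i≤k = refl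

  hit-left : ∀ a a′ → a′ < ℓ → hit a (suc k + a′) ≡ suc (hitPath a 0)
  hit-left a a′ a′<ℓ rewrite ≤ᵇ-false (k<left a′) | <ᵇ-true (+-monoʳ-< (suc k) a′<ℓ) = refl

  hit-right : ∀ a b → hit a (suc k + ℓ + b) ≡ suc (hitPath a k)
  hit-right a b rewrite ≤ᵇ-false (k<right b) | <ᵇ-false {suc k + ℓ + b} {suc k + ℓ} (m≤m+n (suc k + ℓ) b) = refl

  hit-target : ∀ a → a ≤ k → hit a a ≡ 0
  hit-target a a≤k = trans (hit-path a a a≤k) (hitPath-leftOf a a 0 (+-identityʳ a))

  leftSum-hit : ∀ a → leftSum (hit a) ≡ ℓ * suc (hitPath a 0)
  leftSum-hit a = trans (sum<-cong ℓ (λ a′ → hit-left a a′)) (sum<-const ℓ _)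

  rightSum-hit : ∀ a → rightSum (hit a) ≡ r * suc (hitPath a k)
  rightSum-hit a = trans (sum<-cong r (λ b _ → hit-right a b)) (sum<-const r _)

  firstStep-left : ∀ a a′ → a′ < ℓ → FirstStep (hit a) (suc k + a′)
  firstStep-left a a′ a′<ℓ rewrite degree-left a′ a′<ℓ | hit-left a a′ a′<ℓ | neighbourSum-left a′ (hit a) a′<ℓ
    | hit-path a 0 z≤n = +-identityʳ _

  firstStep-right : ∀ a b → FirstStep (hit a) (suc k + ℓ + b)
  firstStep-right a b rewrite degree-right b | hit-right a b | neighbourSum-right b (hit a)
    | hit-path a k ≤-refl = +-identityʳ _

  private
    first<k : ∀ {t} → suc t ≤ k → 0 < k
    first<k t<k = ≤-trans z<s t<k

    leftInner<k : ∀ {a i t} → suc i + suc t ≡ a → a ≤ k → suc i < k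
    leftInner<k {i = i} e a≤k = <-≤-trans (m<m+n (suc i) z<s) (≤-trans (≤-reflexive e) a≤k)

    last>0 : ∀ {a s} → a + suc s ≡ k → 0 < k
    last>0 {a} {s} e = subst (0 <_) (trans (sym (+-suc a s)) e) z<s

    rightInner<k : ∀ {a s m} → a + suc s + suc m ≡ k → suc (a + s) < k
    rightInner<k {a} {s} {m} e = subst (_< k) (+-suc a s) (subst (a + suc s <_) e (m<m+n _ z<s))

    next-offset : ∀ a s m → suc (suc (a + s)) + m ≡ a + suc s + suc m
    next-offset = solve-∀

    previous-offset : ∀ a s m → a + s + suc (suc m) ≡ a + suc s + suc m
    previous-offset = solve-∀

  firstStep-first : ∀ t → suc t ≤ k → FirstStep (hit (suc t)) 0
  firstStep-first t t<k rewrite degree-first (first<k t<k) | neighbourSum-first (hit (suc t)) (first<k t<k)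
    | leftSum-hit (suc t) | hit-path (suc t) 0 z≤n | hit-path (suc t) 1 (first<k t<k)
    | hitPath-leftOf (suc t) 0 (suc t) refl | hitPath-leftOf (suc t) 1 t refl = armHit-end ℓ t

  firstStep-leftInner : ∀ a i t → suc i + suc t ≡ a → a ≤ k → FirstStep (hit a) (suc i)
  firstStep-leftInner a i t e a≤k rewrite degree-inner i (leftInner<k e a≤k) | neighbourSum-inner i (hit a) (leftInner<k e a≤k)
    | hit-path a (suc i) (<⇒≤ (leftInner<k e a≤k)) | hit-path a (suc (suc i)) (leftInner<k e a≤k)
    | hit-path a i (≤-trans (n≤1+n i) (<⇒≤ (leftInner<k e a≤k)))
    | hitPath-leftOf a (suc i) (suc t) e
    | hitPath-leftOf a (suc (suc i)) t (trans (cong suc (sym (+-suc i t))) e)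
    | hitPath-leftOf a i (suc (suc t)) (trans (+-suc i (suc t)) e) = armHit-inner ℓ i t

  firstStep-last : ∀ a s → a + suc s ≡ k → FirstStep (hit a) k
  firstStep-last a s e rewrite degree-last (last>0 e) | neighbourSum-last (hit a) (last>0 e) | rightSum-hit a
    | hit-path a k ≤-refl | hit-path a (pred k) pred[n]≤n
    | hitPath-rightOf a k (suc s) 0 e (+-identityʳ k)
    | hitPath-rightOf a (pred k) s 1 (cong pred (trans (sym (+-suc a s)) e))
                      (trans (+-comm (pred k) 1) (suc-pred k {{>-nonZero (last>0 e)}}))
    = armHit-end r s

  firstStep-rightInner : ∀ a s m → a + suc s + suc m ≡ k → FirstStep (hit a) (suc (a + s))
  firstStep-rightInner a s m e rewrite degree-inner (a + s) (rightInner<k e) | neighbourSum-inner (a + s) (hit a) (rightInner<k e)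
    | hit-path a (suc (a + s)) (<⇒≤ (rightInner<k e)) | hit-path a (suc (suc (a + s))) (rightInner<k e)
    | hit-path a (a + s) (≤-trans (n≤1+n _) (<⇒≤ (rightInner<k e)))
    | hitPath-rightOf a (suc (a + s)) (suc s) (suc m) (+-suc a s) (trans (cong (_+ suc m) (sym (+-suc a s))) e)
    | hitPath-rightOf a (suc (suc (a + s))) (suc (suc s)) m (trans (+-suc a (suc s)) (cong suc (+-suc a s))) (trans (next-offset a s m) e)
    | hitPath-rightOf a (a + s) s (suc (suc m)) refl (trans (previous-offset a s m) e)
    = trans (armHit-inner r m s) (cong (2 +_) (+-comm (armHit r (suc (suc m)) s) _))

  firstStep-leftOf : ∀ a u → u < a → a ≤ k → FirstStep (hit a) u
  firstStep-leftOf (suc t) zero    _   a≤k = firstStep-first t a≤k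
  firstStep-leftOf a       (suc i) u<a a≤k =
    firstStep-leftInner a i (a ∸ suc (suc i)) (trans (+-suc (suc i) _) (m+[n∸m]≡n u<a)) a≤k

  firstStep-rightOf : ∀ a u → a < u → u ≤ k → FirstStep (hit a) u
  firstStep-rightOf a u a<u u≤k = by-distance-to-end (k ∸ u) (m+[n∸m]≡n u≤k)
    where
    s : ℕ
    s = u ∸ suc a
    a+s+1≡u : a + suc s ≡ u
    a+s+1≡u = trans (+-suc a s) (m+[n∸m]≡n a<u)
    by-distance-to-end : ∀ m → u + m ≡ k → FirstStep (hit a) u
    by-distance-to-end zero    u+0≡k = subst (FirstStep (hit a)) (sym (trans (sym (+-identityʳ u)) u+0≡k))
                                             (firstStep-last a s (trans a+s+1≡u (trans (sym (+-identityʳ u)) u+0≡k)))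
    by-distance-to-end (suc m) u+m≡k = subst (FirstStep (hit a)) (trans (sym (+-suc a s)) a+s+1≡u)
                                             (firstStep-rightInner a s m (trans (cong (_+ suc m) a+s+1≡u) u+m≡k))

  hit-firstStep : ∀ a u → a ≤ k → u < order → u ≢ a → FirstStep (hit a) u
  hit-firstStep a u a≤k u<order u≢a with vertex u u<order
  ... | left a′ a′<ℓ refl = firstStep-left a a′ a′<ℓ
  ... | right b _ refl    = firstStep-right a b
  ... | path u≤k with <-cmp u a
  ...   | tri< u<a _ _   = firstStep-leftOf a u u<a a≤k
  ...   | tri≈ _ u≡a _   = ⊥-elim (u≢a u≡a)
  ...   | tri> _ _ a<u   = firstStep-rightOf a u a<u u≤k

  joinℕ : (ℕ → ℕ) → ℕ
  joinℕ h = sum< order (λ j → degreeℕ j * h j)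

  private
    degree-fromLeft : ∀ i a → i < a → a ≤ k → degreeℕ i ≡ armDegree ℓ i
    degree-fromLeft zero    a 0<a a≤k = degree-first (≤-trans 0<a a≤k)
    degree-fromLeft (suc i) a i<a a≤k = degree-inner i (≤-trans i<a a≤k)

    degree-fromRight : ∀ u s → 0 < u → u + s ≡ k → degreeℕ u ≡ armDegree r s
    degree-fromRight u       zero    0<u u+0≡k = trans (cong degreeℕ u≡k) (degree-last (subst (0 <_) u≡k 0<u))
      where
      u≡k : u ≡ k
      u≡k = trans (sym (+-identityʳ u)) u+0≡k
    degree-fromRight (suc u) (suc s) _   u+s≡k = degree-inner u (subst (suc u <_) u+s≡k (m<m+n (suc u) z<s))

    join-leftLeaves : ∀ a → leftSum (λ j → degreeℕ j * hit a j) ≡ ℓ * suc (armHit ℓ 0 a)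
    join-leftLeaves a = trans (sum<-cong ℓ (λ a′ a′<ℓ → cong₂ _*_ (degree-left a′ a′<ℓ)
                                (trans (hit-left a a′ a′<ℓ) (cong suc (hitPath-leftOf a 0 a refl)))))
                              (trans (sum<-cong ℓ (λ _ _ → +-identityʳ _)) (sum<-const ℓ _))

    join-rightLeaves : ∀ a b → a + b ≡ k → rightSum (λ j → degreeℕ j * hit a j) ≡ r * suc (armHit r 0 b)
    join-rightLeaves a b a+b≡k = trans (sum<-cong r (λ b′ _ → cong₂ _*_ (degree-right b′)
                                   (trans (hit-right a b′) (cong suc (hitPath-rightOf a k b 0 a+b≡k (+-identityʳ k))))))
                                 (trans (sum<-cong r (λ _ _ → +-identityʳ _)) (sum<-const r _))

    join-beforeTarget : ∀ a → a ≤ k → sum< a (λ j → degreeℕ j * hit a j) ≡ armPathJoin ℓ a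
    join-beforeTarget a a≤k = sum<-cong a (λ i i<a → cong₂ _*_ (degree-fromLeft i a i<a a≤k)
      (trans (hit-path a i (≤-trans (<⇒≤ i<a) a≤k)) (hitPath-leftOf a i (a ∸ i) (m+[n∸m]≡n (<⇒≤ i<a)))))

    join-afterTarget : ∀ a b → a + b ≡ k → sum< b (λ s → degreeℕ (a + suc s) * hit a (a + suc s)) ≡ armPathJoin r b
    join-afterTarget a b a+b≡k = trans (sum<-reverse b _) (sum<-cong b term)
      where
      term : ∀ s → s < b → degreeℕ (a + suc (b ∸ suc s)) * hit a (a + suc (b ∸ suc s)) ≡ armDegree r s * armHit r s (b ∸ s)
      term s s<b = cong₂ _*_
        (degree-fromRight u s (subst (0 <_) (sym (+-suc a _)) z<s) u+s≡k)
        (trans (hit-path a u (subst (u ≤_) u+s≡k (m≤m+n u s)))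
               (trans (hitPath-rightOf a u (suc (b ∸ suc s)) s refl u+s≡k) (cong (armHit r s) (sym (+-∸-assoc 1 s<b)))))
        where
        u : ℕ
        u = a + suc (b ∸ suc s)
        u+s≡k : u + s ≡ k
        u+s≡k = trans (+-assoc a _ s) (trans (cong (a +_) (trans (cong (_+ s) (sym (+-∸-assoc 1 s<b))) (m∸n+n≡m (<⇒≤ s<b)))) a+b≡k)

    join-path : ∀ a b → a + b ≡ k → sum< (suc k) (λ j → degreeℕ j * hit a j) ≡ armPathJoin ℓ a + armPathJoin r b
    join-path a b a+b≡k = begin
      sum< (suc k) F                                         ≡⟨ cong (λ n → sum< n F) (trans (cong suc (sym a+b≡k)) (sym (+-suc a b))) ⟩
      sum< (a + suc b) F                                     ≡⟨ sum<-++ a (suc b) F ⟩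
      sum< a F + (F (a + 0) + sum< b (λ s → F (a + suc s)))  ≡⟨ cong₂ _+_ (join-beforeTarget a a≤k) (cong₂ _+_ at-target (join-afterTarget a b a+b≡k)) ⟩
      armPathJoin ℓ a + (0 + armPathJoin r b)                ∎
      where
      open ≡-Reasoning
      F : ℕ → ℕ
      F j = degreeℕ j * hit a j
      a≤k : a ≤ k
      a≤k = subst (a ≤_) a+b≡k (m≤m+n a b)
      at-target : F (a + 0) ≡ 0
      at-target = trans (cong F (+-identityʳ a)) (trans (cong (degreeℕ a *_) (hit-target a a≤k)) (*-zeroʳ (degreeℕ a)))

  joinℕ-hit : ∀ a b → a + b ≡ k → joinℕ (hit a) ≡ (ℓ + crossSquares ℓ a) + (r + crossSquares r b)
  joinℕ-hit a b a+b≡k = begin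
    joinℕ (hit a)
      ≡⟨ sum<-order (λ j → degreeℕ j * hit a j) ⟩
    sum< (suc k) (λ j → degreeℕ j * hit a j) + leftSum (λ j → degreeℕ j * hit a j) + rightSum (λ j → degreeℕ j * hit a j)
      ≡⟨ cong₂ _+_ (cong₂ _+_ (join-path a b a+b≡k) (join-leftLeaves a)) (join-rightLeaves a b a+b≡k) ⟩
    armPathJoin ℓ a + armPathJoin r b + ℓ * suc (armHit ℓ 0 a) + r * suc (armHit r 0 b)
      ≡⟨ interchange (armPathJoin ℓ a) (armPathJoin r b) _ _ ⟩
    armJoin ℓ a + armJoin r b
      ≡⟨ cong₂ _+_ (armJoin≡ ℓ a) (armJoin≡ r b) ⟩
    (ℓ + crossSquares ℓ a) + (r + crossSquares r b) ∎
    where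
    open ≡-Reasoning
    interchange : ∀ w x y z → w + x + y + z ≡ (w + y) + (x + z)
    interchange = solve-∀

  neighbourSum-+const : ∀ u h c → neighbourSumℕ u (λ j → h j + c) ≡ neighbourSumℕ u h + degreeℕ u * c
  neighbourSum-+const u h c = begin
    neighbourSumℕ u (λ j → h j + c)
      ≡⟨ sum<-cong order (λ j _ → split j (adj u j)) ⟩
    sum< order (λ j → (if adj u j then h j else 0) + c * (if adj u j then 1 else 0))
      ≡⟨ sum<-+ order (λ j → if adj u j then h j else 0) (λ j → c * (if adj u j then 1 else 0)) ⟩
    neighbourSumℕ u h + sum< order (λ j → c * (if adj u j then 1 else 0))
      ≡⟨ cong (neighbourSumℕ u h +_) (trans (sum<-*ˡ order c (λ j → if adj u j then 1 else 0)) (*-comm c (degreeℕ u))) ⟩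
    neighbourSumℕ u h + degreeℕ u * c ∎
    where
    open ≡-Reasoning
    split : ∀ j e → (if e then h j + c else 0) ≡ (if e then h j else 0) + c * (if e then 1 else 0)
    split j true  = cong (h j +_) (sym (*-identityʳ c))
    split j false = sym (*-zeroʳ c)

  firstStep-+const : ∀ h c u → FirstStep h u → FirstStep (λ j → h j + c) u
  firstStep-+const h c u step = begin
    degreeℕ u * (h u + c)                                   ≡⟨ *-distribˡ-+ (degreeℕ u) (h u) c ⟩
    degreeℕ u * h u + degreeℕ u * c                         ≡⟨ cong (_+ degreeℕ u * c) step ⟩
    degreeℕ u + neighbourSumℕ u h + degreeℕ u * c           ≡⟨ +-assoc (degreeℕ u) _ _ ⟩
    degreeℕ u + (neighbourSumℕ u h + degreeℕ u * c)         ≡⟨ cong (degreeℕ u +_) (neighbourSum-+const u h c) ⟨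
    degreeℕ u + neighbourSumℕ u (λ j → h j + c)             ∎
    where open ≡-Reasoning

  -- The walk reaches the leaf t only through its neighbour p, so hit p shifted by H(p,t) = c hits t.
  module LeafTarget (t p : ℕ) (t<order : t < order) (p≤k : p ≤ k) (t≢p : t ≢ p)
                    (adj-t : ∀ u → u < order → adj u t ≡ (u ≡ᵇ p)) (2≤degree-p : 2 ≤ degreeℕ p) where

    -- The value of H(p, t) forced by the first-step equation at p.
    c : ℕ
    c = degreeℕ p + neighbourSumℕ p (hit p) ∸ 1

    hitLeaf : ℕ → ℕ
    hitLeaf u = if u ≡ᵇ t then 0 else hit p u + c

    hitLeaf-target : hitLeaf t ≡ 0
    hitLeaf-target rewrite ≡ᵇ-true {t} refl = refl

    private
      neighbourSum-leaf : ∀ h → neighbourSumℕ t h ≡ h p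
      neighbourSum-leaf h = begin
        neighbourSumℕ t h
          ≡⟨ sum<-cong order (λ j j<order → cong (λ e → if e then h j else 0) (trans (adj-sym t j) (adj-t j j<order))) ⟩
        sum< order (λ j → if j ≡ᵇ p then h j else 0)
          ≡⟨ sum<-indicatorʳ order p h ⟩
        (if p <ᵇ order then h p else 0)
          ≡⟨ cong (λ e → if e then h p else 0) (<ᵇ-true (path<order p≤k)) ⟩
        h p ∎
        where open ≡-Reasoning

      hit-leaf : hit p t ≡ 1
      hit-leaf = begin
        hit p t                                  ≡⟨ *-identityˡ (hit p t) ⟨
        1 * hit p t                              ≡⟨ cong (_* hit p t) (neighbourSum-leaf (const 1)) ⟨
        degreeℕ t * hit p t                      ≡⟨ hit-firstStep p t p≤k t<order t≢p ⟩
        degreeℕ t + neighbourSumℕ t (hit p)      ≡⟨ cong₂ _+_ (neighbourSum-leaf (const 1)) (neighbourSum-leaf (hit p)) ⟩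
        1 + hit p p                              ≡⟨ cong suc (hit-target p p≤k) ⟩
        1                                        ∎
        where open ≡-Reasoning

      hitLeaf-off : ∀ u → u ≢ t → hitLeaf u ≡ hit p u + c
      hitLeaf-off u u≢t rewrite ≡ᵇ-false u≢t = refl

      neighbourSum-away : ∀ u → u < order → u ≢ p → neighbourSumℕ u hitLeaf ≡ neighbourSumℕ u (λ j → hit p j + c)
      neighbourSum-away u u<order u≢p = sum<-cong order same
        where
        same : ∀ j → j < order → neighbourTerm u hitLeaf j ≡ neighbourTerm u (λ j → hit p j + c) j
        same j _ with j ≟ t
        ... | yes refl rewrite adj-t u u<order | ≡ᵇ-false u≢p = refl
        ... | no  j≢t  = cong (λ x → if adj u j then x else 0) (hitLeaf-off j j≢t)

      neighbourSum-parent : neighbourSumℕ p hitLeaf + (1 + c) ≡ neighbourSumℕ p (hit p) + degreeℕ p * c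
      neighbourSum-parent = begin
        neighbourSumℕ p hitLeaf + (1 + c)
          ≡⟨ cong (λ x → neighbourSumℕ p hitLeaf + (x + c)) hit-leaf ⟨
        neighbourSumℕ p hitLeaf + (hit p t + c)
          ≡⟨ cong (λ e → neighbourSumℕ p hitLeaf + (if e then hit p t + c else 0)) adj-p-t ⟨
        neighbourSumℕ p hitLeaf + neighbourTerm p (λ j → hit p j + c) t
          ≡⟨ sum<-update order t (neighbourTerm p hitLeaf) (neighbourTerm p (λ j → hit p j + c)) t<order
               (λ j _ j≢t → cong (λ x → if adj p j then x else 0) (hitLeaf-off j j≢t)) ⟩
        neighbourSumℕ p (λ j → hit p j + c) + neighbourTerm p hitLeaf t
          ≡⟨ cong₂ _+_ (neighbourSum-+const p (hit p) c) (trans (cong (λ x → if x then hitLeaf t else 0) adj-p-t) hitLeaf-target) ⟩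
        neighbourSumℕ p (hit p) + degreeℕ p * c + 0
          ≡⟨ +-identityʳ _ ⟩
        neighbourSumℕ p (hit p) + degreeℕ p * c ∎
        where
        open ≡-Reasoning
        adj-p-t : adj p t ≡ true
        adj-p-t = trans (adj-t p (path<order p≤k)) (≡ᵇ-true {p} refl)

      1+c≡ : 1 + c ≡ degreeℕ p + neighbourSumℕ p (hit p)
      1+c≡ = m+[n∸m]≡n (≤-trans (≤-trans (s≤s z≤n) 2≤degree-p) (m≤m+n _ _))

      parent-step : degreeℕ p * c ≡ degreeℕ p + neighbourSumℕ p hitLeaf
      parent-step = +-cancelʳ-≡ N (D * c) (D + N′) (begin
        D * c + N       ≡⟨ +-comm (D * c) N ⟩
        N + D * c       ≡⟨ neighbourSum-parent ⟨
        N′ + (1 + c)    ≡⟨ cong (N′ +_) 1+c≡ ⟩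
        N′ + (D + N)    ≡⟨ rearrange N′ D N ⟩
        D + N′ + N      ∎)
        where
        open ≡-Reasoning
        D N N′ : ℕ
        D = degreeℕ p
        N = neighbourSumℕ p (hit p)
        N′ = neighbourSumℕ p hitLeaf
        rearrange : ∀ x y z → x + (y + z) ≡ y + x + z
        rearrange = solve-∀

    hitLeaf-firstStep : ∀ u → u < order → u ≢ t → FirstStep hitLeaf u
    hitLeaf-firstStep u u<order u≢t with u ≟ p
    ... | no u≢p rewrite hitLeaf-off u u≢t | neighbourSum-away u u<order u≢p =
      firstStep-+const (hit p) c u (hit-firstStep p u p≤k u<order u≢p)
    ... | yes refl rewrite hitLeaf-off u u≢t | hit-target u p≤k = parent-step

    -- Shifting by c costs at most 1 at t but adds c to every other term of the joining sum.
    joinℕ-hit≤joinℕ-hitLeaf : joinℕ (hit p) ≤ joinℕ hitLeaf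
    joinℕ-hit≤joinℕ-hitLeaf = +-cancelʳ-≤ (1 + c) (joinℕ (hit p)) (joinℕ hitLeaf) (begin
      joinℕ (hit p) + (1 + c)                        ≤⟨ +-monoʳ-≤ (joinℕ (hit p)) 1+c≤c*D ⟩
      joinℕ (hit p) + c * Dtot                       ≡⟨ shifted-sum ⟨
      sum< order (λ j → degreeℕ j * (hit p j + c))   ≡⟨ +-identityʳ _ ⟨
      sum< order (λ j → degreeℕ j * (hit p j + c)) + 0
        ≡⟨ cong (sum< order (λ j → degreeℕ j * (hit p j + c)) +_)
                (trans (cong (degreeℕ t *_) hitLeaf-target) (*-zeroʳ (degreeℕ t))) ⟨
      sum< order (λ j → degreeℕ j * (hit p j + c)) + degreeℕ t * hitLeaf t
        ≡⟨ sum<-update order t _ _ t<order (λ j _ j≢t → cong (degreeℕ j *_) (hitLeaf-off j j≢t)) ⟨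
      joinℕ hitLeaf + degreeℕ t * (hit p t + c)
        ≡⟨ cong (joinℕ hitLeaf +_) (cong₂ _*_ (neighbourSum-leaf (const 1)) (cong (_+ c) hit-leaf)) ⟩
      joinℕ hitLeaf + 1 * (1 + c)                    ≡⟨ cong (joinℕ hitLeaf +_) (*-identityˡ (1 + c)) ⟩
      joinℕ hitLeaf + (1 + c)                        ∎)
      where
      open ≤-Reasoning
      Dtot : ℕ
      Dtot = sum< order degreeℕ
      shifted-sum : sum< order (λ j → degreeℕ j * (hit p j + c)) ≡ joinℕ (hit p) + c * Dtot
      shifted-sum = trans (sum<-cong order (λ j _ → trans (*-distribˡ-+ (degreeℕ j) (hit p j) c) (cong (degreeℕ j * hit p j +_) (*-comm (degreeℕ j) c))))
                          (trans (sum<-+ order (λ j → degreeℕ j * hit p j) (λ j → c * degreeℕ j))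
                                 (cong (joinℕ (hit p) +_) (sum<-*ˡ order c degreeℕ)))
      1≤c : 1 ≤ c
      1≤c = +-cancelˡ-≤ 1 1 c (subst (2 ≤_) (sym 1+c≡) (≤-trans 2≤degree-p (m≤m+n _ _)))
      1+c≤c*D : 1 + c ≤ c * Dtot
      1+c≤c*D = begin
        1 + c      ≤⟨ +-monoˡ-≤ c 1≤c ⟩
        c + c      ≡⟨ cong (c +_) (+-identityʳ c) ⟨
        2 * c      ≡⟨ *-comm 2 c ⟩
        c * 2      ≤⟨ *-monoʳ-≤ c (≤-trans 2≤degree-p (term≤sum< order p degreeℕ (path<order p≤k))) ⟩
        c * Dtot   ∎

-- Joining times of the double broom

pathJoin : ℕ → ℕ → ℕ → ℕ → ℕ
pathJoin k ℓ r a = (ℓ + crossSquares ℓ a) + (r + crossSquares r (k ∸ a))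

module BroomJoin (k ℓ r : ℕ) where
  open Broom k ℓ r
  open BroomHitting k ℓ r

  G : Graph order
  G = doubleBroom (suc (suc k)) ℓ r

  deg≡degreeℕ : ∀ u → deg G u ≡ degreeℕ (toℕ u)
  deg≡degreeℕ u = countFin≡sum< order (adj (toℕ u))

  private
    parentℕ : ∀ j → Vertex j → ℕ
    parentℕ j (path _)      = pred j
    parentℕ j (left _ _ _)  = 0
    parentℕ j (right _ _ _) = k

    parentℕ-adj-< : ∀ j (x : Vertex j) → j ≢ 0 → (adj j (parentℕ j x) ≡ true) × (parentℕ j x < j)
    parentℕ-adj-< zero    (path _)   j≢0 = ⊥-elim (j≢0 refl)
    parentℕ-adj-< (suc i) (path i<k) _   =
      trans (adj-path-path (suc i) i i<k (≤-trans (n≤1+n i) i<k)) (trans (cong ((suc (suc i) ≡ᵇ i) ∨_) (≡ᵇ-true {i} refl)) (∨-zeroʳ (suc (suc i) ≡ᵇ i))) , n<1+n i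
    parentℕ-adj-< _ (left a a<ℓ refl) _ = adj-left-path a 0 a<ℓ , s≤s z≤n
    parentℕ-adj-< _ (right b _ refl)  _ = trans (adj-right-path b k) (≡ᵇ-true {k} refl) , k<right b

    parentℕ≤ : ∀ j (x : Vertex j) → parentℕ j x ≤ j
    parentℕ≤ zero    (path _) = z≤n
    parentℕ≤ (suc i) (path _) = n≤1+n i
    parentℕ≤ _ (left _ _ _)   = z≤n
    parentℕ≤ _ (right b _ refl) = <⇒≤ (k<right b)

    vertexOf : ∀ u → Vertex (toℕ u)
    vertexOf u = vertex (toℕ u) (FP.toℕ<n u)

    parent : Fin order → Fin order
    parent u = F.fromℕ< (≤-<-trans (parentℕ≤ (toℕ u) (vertexOf u)) (FP.toℕ<n u))

    toℕ-parent : ∀ u → toℕ (parent u) ≡ parentℕ (toℕ u) (vertexOf u)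
    toℕ-parent u = FP.toℕ-fromℕ< _

    parent-adj : ∀ u → u ≢ F.zero → G u (parent u) ≡ true
    parent-adj u u≢0 = trans (cong (adj (toℕ u)) (toℕ-parent u))
                             (proj₁ (parentℕ-adj-< (toℕ u) (vertexOf u) (u≢0 ∘ FP.toℕ-injective)))

  spanningTree : SpanningTree G
  spanningTree = record
    { root       = F.zero
    ; parent     = parent
    ; toParent   = parent-adj
    ; fromParent = λ u u≢0 → trans (adj-sym (toℕ (parent u)) (toℕ u)) (parent-adj u u≢0)
    ; parent-<   = λ u u≢0 → subst (_< toℕ u) (sym (toℕ-parent u)) (proj₂ (parentℕ-adj-< (toℕ u) (vertexOf u) (u≢0 ∘ FP.toℕ-injective)))
    }

  private
    if-ℕ→ℚ : ∀ e x → (if e then ℕ→ℚ x else 0ℚ) ≡ ℕ→ℚ (if e then x else 0)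
    if-ℕ→ℚ true  x = refl
    if-ℕ→ℚ false x = refl

    neighbourSum-ℕ→ℚ : ∀ u h → neighbourSum G u (λ w → ℕ→ℚ (h (toℕ w))) ≡ ℕ→ℚ (neighbourSumℕ (toℕ u) h)
    neighbourSum-ℕ→ℚ u h = trans (sumFin-cong order (λ w → if-ℕ→ℚ (adj (toℕ u) (toℕ w)) (h (toℕ w))))
                                 (sumFin-ℕ→ℚ order (λ j → if adj (toℕ u) j then h j else 0))

  hittingSystem : ∀ h v → h (toℕ v) ≡ 0 → (∀ u → u < order → u ≢ toℕ v → FirstStep h u) →
                  HittingSystem G v (λ u → ℕ→ℚ (h (toℕ u)))
  hittingSystem h v hv≡0 steps = cong ℕ→ℚ hv≡0 , equation
    where
    equation : ∀ u → u ≢ v → ℕ→ℚ (deg G u) ℚ.* ℕ→ℚ (h (toℕ u)) ≡ ℕ→ℚ (deg G u) ℚ.+ neighbourSum G u (λ w → ℕ→ℚ (h (toℕ w)))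
    equation u u≢v = begin
      ℕ→ℚ d ℚ.* ℕ→ℚ (h (toℕ u))                          ≡⟨ ℕ→ℚ-* d (h (toℕ u)) ⟨
      ℕ→ℚ (d * h (toℕ u))                                 ≡⟨ cong ℕ→ℚ step ⟩
      ℕ→ℚ (d + neighbourSumℕ (toℕ u) h)                   ≡⟨ ℕ→ℚ-+ d _ ⟩
      ℕ→ℚ d ℚ.+ ℕ→ℚ (neighbourSumℕ (toℕ u) h)             ≡⟨ cong (ℕ→ℚ d ℚ.+_) (neighbourSum-ℕ→ℚ u h) ⟨
      ℕ→ℚ d ℚ.+ neighbourSum G u (λ w → ℕ→ℚ (h (toℕ w)))  ∎
      where
      open ≡-Reasoning
      d : ℕ
      d = deg G u
      step : d * h (toℕ u) ≡ d + neighbourSumℕ (toℕ u) h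
      step = subst (λ x → x * h (toℕ u) ≡ x + neighbourSumℕ (toℕ u) h) (sym (deg≡degreeℕ u))
                   (steps (toℕ u) (FP.toℕ<n u) (u≢v ∘ FP.toℕ-injective))

  J≡joinℕ : ∀ {H} → IsHittingTime G H → ∀ v h → HittingSystem G v (λ u → ℕ→ℚ (h (toℕ u))) → J G H v ≡ ℕ→ℚ (joinℕ h)
  J≡joinℕ {H} (H-diag , H-step) v h system = begin
    sumFin order (λ u → ℕ→ℚ (deg G u) ℚ.* H u v)
      ≡⟨ sumFin-cong order (λ u → cong₂ ℚ._*_ (cong ℕ→ℚ (deg≡degreeℕ u)) (H≡h u)) ⟩
    sumFin order (λ u → ℕ→ℚ (degreeℕ (toℕ u)) ℚ.* ℕ→ℚ (h (toℕ u)))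
      ≡⟨ sumFin-cong order (λ u → ℕ→ℚ-* (degreeℕ (toℕ u)) (h (toℕ u))) ⟨
    sumFin order (λ u → ℕ→ℚ (degreeℕ (toℕ u) * h (toℕ u)))
      ≡⟨ sumFin-ℕ→ℚ order (λ j → degreeℕ j * h j) ⟩
    ℕ→ℚ (joinℕ h) ∎
    where
    open ≡-Reasoning
    H≡h : ∀ u → H u v ≡ ℕ→ℚ (h (toℕ u))
    H≡h = hitting-unique spanningTree (H-diag v , λ u u≢v → H-step u v u≢v) system

  J-path : ∀ {H} → IsHittingTime G H → ∀ v → toℕ v ≤ k → J G H v ≡ ℕ→ℚ (pathJoin k ℓ r (toℕ v))
  J-path isH v v≤k = trans
    (J≡joinℕ isH v (hit a) (hittingSystem (hit a) v (hit-target a v≤k) (λ u u<order u≢a → hit-firstStep a u v≤k u<order u≢a)))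
    (cong ℕ→ℚ (joinℕ-hit a (k ∸ a) (m+[n∸m]≡n v≤k)))
    where
    a : ℕ
    a = toℕ v

  private
    J-leaf : ∀ {H} → IsHittingTime G H → ∀ v p (p≤k : p ≤ k) (v≢p : toℕ v ≢ p)
             (adj-v : ∀ u → u < order → adj u (toℕ v) ≡ (u ≡ᵇ p)) → 2 ≤ degreeℕ p →
             ℕ→ℚ (pathJoin k ℓ r p) ≤ℚ J G H v
    J-leaf {H} isH v p p≤k v≢p adj-v 2≤degree = begin
      ℕ→ℚ (pathJoin k ℓ r p)   ≡⟨ cong ℕ→ℚ (joinℕ-hit p (k ∸ p) (m+[n∸m]≡n p≤k)) ⟨
      ℕ→ℚ (joinℕ (hit p))      ≤⟨ ℕ→ℚ-mono-≤ joinℕ-hit≤joinℕ-hitLeaf ⟩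
      ℕ→ℚ (joinℕ hitLeaf)      ≡⟨ J≡joinℕ isH v hitLeaf (hittingSystem hitLeaf v hitLeaf-target hitLeaf-firstStep) ⟨
      J G H v                  ∎
      where
      open ℚP.≤-Reasoning
      open LeafTarget (toℕ v) p (FP.toℕ<n v) p≤k v≢p adj-v 2≤degree

    adj-to-left : ∀ a → a < ℓ → ∀ u → u < order → adj u (suc k + a) ≡ (u ≡ᵇ 0)
    adj-to-left a a<ℓ u u<order with vertex u u<order
    ... | path _           = adj-path-left u a a<ℓ
    ... | left a′ _ refl   = adj-leaf-leaf _ _ (k<left a′) (k<left a)
    ... | right b′ _ refl  = adj-leaf-leaf _ _ (k<right b′) (k<left a)

    adj-to-right : ∀ b → ∀ u → u < order → adj u (suc k + ℓ + b) ≡ (u ≡ᵇ k)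
    adj-to-right b u u<order with vertex u u<order
    ... | path _           = adj-path-right u b
    ... | left a′ _ refl   = trans (adj-leaf-leaf _ _ (k<left a′) (k<right b)) (sym (≡ᵇ-false (>⇒≢ (k<left a′))))
    ... | right b′ _ refl  = trans (adj-leaf-leaf _ _ (k<right b′) (k<right b)) (sym (≡ᵇ-false (>⇒≢ (k<right b′))))

    module _ (1≤ℓ : 1 ≤ ℓ) (1≤r : 1 ≤ r) where
      2≤degree-first : 2 ≤ degreeℕ 0
      2≤degree-first with k ≟ 0
      ... | yes k≡0 = subst (2 ≤_) (sym (degree-centre k≡0)) (+-mono-≤ 1≤ℓ 1≤r)
      ... | no  k≢0 = subst (2 ≤_) (sym (degree-first (n≢0⇒n>0 k≢0))) (s≤s 1≤ℓ)

      2≤degree-last : 2 ≤ degreeℕ k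
      2≤degree-last with k ≟ 0
      ... | yes refl = 2≤degree-first
      ... | no  k≢0  = subst (2 ≤_) (sym (degree-last (n≢0⇒n>0 k≢0))) (s≤s 1≤r)

  J≥pathJoin : 1 ≤ ℓ → 1 ≤ r → ∀ {H} → IsHittingTime G H → ∀ v →
               ∃ λ a → a ≤ k × ℕ→ℚ (pathJoin k ℓ r a) ≤ℚ J G H v
  J≥pathJoin 1≤ℓ 1≤r {H} isH v = by-vertex (vertex (toℕ v) (FP.toℕ<n v))
    where
    by-vertex : Vertex (toℕ v) → ∃ λ a → a ≤ k × ℕ→ℚ (pathJoin k ℓ r a) ≤ℚ J G H v
    by-vertex (path v≤k)      = toℕ v , v≤k , ℚP.≤-reflexive (sym (J-path isH v v≤k))
    by-vertex (left a a<ℓ v≡) = 0 , z≤n , J-leaf isH v 0 z≤n (λ v≡0 → 0≢1+n (trans (sym v≡0) v≡))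
                                  (subst (λ t → ∀ u → u < order → adj u t ≡ (u ≡ᵇ 0)) (sym v≡) (adj-to-left a a<ℓ))
                                  (2≤degree-first 1≤ℓ 1≤r)
    by-vertex (right b _ v≡)  = k , ≤-refl , J-leaf isH v k ≤-refl (λ v≡k → <⇒≢ (k<right b) (sym (trans (sym v≡) v≡k)))
                                  (subst (λ t → ∀ u → u < order → adj u t ≡ (u ≡ᵇ k)) (sym v≡) (adj-to-right b))
                                  (2≤degree-last 1≤ℓ 1≤r)

minUpTo : ℕ → (ℕ → ℕ) → ℕ
minUpTo zero    f = f 0
minUpTo (suc k) f = minUpTo k f ⊓ f (suc k)

minUpTo-≤ : ∀ k f {a} → a ≤ k → minUpTo k f ≤ f a
minUpTo-≤ zero    f z≤n = ≤-refl
minUpTo-≤ (suc k) f {a} a≤k+1 with m≤n⇒m<n∨m≡n a≤k+1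
... | inj₁ a<k+1 = ≤-trans (m⊓n≤m (minUpTo k f) _) (minUpTo-≤ k f (≤-pred a<k+1))
... | inj₂ refl  = m⊓n≤n (minUpTo k f) _

minUpTo-attained : ∀ k f → ∃ λ a → a ≤ k × minUpTo k f ≡ f a
minUpTo-attained zero    f = 0 , z≤n , refl
minUpTo-attained (suc k) f with ⊓-sel (minUpTo k f) (f (suc k))
... | inj₂ min≡last = suc k , ≤-refl , min≡last
... | inj₁ min≡prev with minUpTo-attained k f
...   | a , a≤k , prev≡fa = a , m≤n⇒m≤1+n a≤k , trans min≡prev prev≡fa

minFin-≤ : ∀ n (f : Fin (suc n) → ℚ) u → minFin (suc n) f ≤ℚ f u
minFin-≤ zero    f F.zero    = ℚP.≤-refl
minFin-≤ (suc n) f F.zero    = ℚP.p⊓q≤p (f F.zero) _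
minFin-≤ (suc n) f (F.suc u) = ℚP.≤-trans (ℚP.p⊓q≤q (f F.zero) _) (minFin-≤ n (f ∘ F.suc) u)

minFin-attained : ∀ n (f : Fin (suc n) → ℚ) → ∃ λ u → minFin (suc n) f ≡ f u
minFin-attained zero    f = F.zero , refl
minFin-attained (suc n) f with ℚP.⊓-sel (f F.zero) (minFin (suc n) (f ∘ F.suc))
... | inj₁ min≡head = F.zero , min≡head
... | inj₂ min≡tail with minFin-attained n (f ∘ F.suc)
...   | u , tail≡fu = F.suc u , trans min≡tail tail≡fu

minJ-doubleBroom : ∀ k ℓ r → 1 ≤ ℓ → 1 ≤ r → ∀ {H} → IsHittingTime (doubleBroom (suc (suc k)) ℓ r) H →
                   minJ (doubleBroom (suc (suc k)) ℓ r) H ≡ ℕ→ℚ (minUpTo k (pathJoin k ℓ r))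
minJ-doubleBroom k ℓ r 1≤ℓ 1≤r {H} isH = ℚP.≤-antisym (minJ≤ (minUpTo-attained k (pathJoin k ℓ r)))
                                                       (≤minJ (minFin-attained (k + ℓ + r) (J G H)))
  where
  open Broom k ℓ r using (order; path<order)
  open BroomJoin k ℓ r
  minJ≤ : (∃ λ a → a ≤ k × minUpTo k (pathJoin k ℓ r) ≡ pathJoin k ℓ r a) →
          minJ G H ≤ℚ ℕ→ℚ (minUpTo k (pathJoin k ℓ r))
  minJ≤ (a , a≤k , min≡) = begin
    minJ G H                                  ≤⟨ minFin-≤ (k + ℓ + r) (J G H) v ⟩
    J G H v                                   ≡⟨ J-path isH v (subst (_≤ k) (sym toℕ-v) a≤k) ⟩
    ℕ→ℚ (pathJoin k ℓ r (toℕ v))              ≡⟨ cong (ℕ→ℚ ∘ pathJoin k ℓ r) toℕ-v ⟩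
    ℕ→ℚ (pathJoin k ℓ r a)                    ≡⟨ cong ℕ→ℚ min≡ ⟨
    ℕ→ℚ (minUpTo k (pathJoin k ℓ r))          ∎
    where
    open ℚP.≤-Reasoning
    v : Fin order
    v = F.fromℕ< (path<order a≤k)
    toℕ-v : toℕ v ≡ a
    toℕ-v = FP.toℕ-fromℕ< (path<order a≤k)
  ≤minJ : (∃ λ v → minJ G H ≡ J G H v) → ℕ→ℚ (minUpTo k (pathJoin k ℓ r)) ≤ℚ minJ G H
  ≤minJ (v , minJ≡) = let a , a≤k , path≤J = J≥pathJoin 1≤ℓ 1≤r isH v in begin
    ℕ→ℚ (minUpTo k (pathJoin k ℓ r))    ≤⟨ ℕ→ℚ-mono-≤ (minUpTo-≤ k (pathJoin k ℓ r) a≤k) ⟩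
    ℕ→ℚ (pathJoin k ℓ r a)              ≤⟨ path≤J ⟩
    J G H v                             ≡⟨ minJ≡ ⟨
    minJ G H                            ∎
    where open ℚP.≤-Reasoning

-- Moving leaves towards the balanced position

crossTime-shift : ∀ c j → crossTime (suc c) j ≡ crossTime c (suc j)
crossTime-shift = unfolded
  where
  unfolded : ∀ c j → suc (suc c + suc c + j + j) ≡ suc (c + c + suc j + suc j)
  unfolded = solve-∀

crossSquares-cons : ∀ c a → crossSquares c (suc a) ≡ crossTime c 0 * crossTime c 0 + crossSquares (suc c) a
crossSquares-cons c zero    = +-comm 0 _
crossSquares-cons c (suc a) = begin
  crossSquares c (suc a) + crossTime c (suc a) * crossTime c (suc a)
    ≡⟨ cong (_+ crossTime c (suc a) * crossTime c (suc a)) (crossSquares-cons c a) ⟩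
  crossTime c 0 * crossTime c 0 + crossSquares (suc c) a + crossTime c (suc a) * crossTime c (suc a)
    ≡⟨ +-assoc (crossTime c 0 * crossTime c 0) _ _ ⟩
  crossTime c 0 * crossTime c 0 + (crossSquares (suc c) a + crossTime c (suc a) * crossTime c (suc a))
    ≡⟨ cong (λ x → crossTime c 0 * crossTime c 0 + (crossSquares (suc c) a + x * x)) (crossTime-shift c a) ⟨
  crossTime c 0 * crossTime c 0 + crossSquares (suc c) (suc a) ∎
  where open ≡-Reasoning

crossTime-<-suc : ∀ c j → crossTime c j < crossTime (suc c) j
crossTime-<-suc c j = s≤s (subst (suc (c + c + j + j) ≤_) (sym (unfolded c j)) (n≤1+n _))
  where
  unfolded : ∀ c j → suc c + suc c + j + j ≡ suc (suc (c + c + j + j))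
  unfolded = solve-∀

crossSquares-≤-suc : ∀ c a → crossSquares c a ≤ crossSquares (suc c) a
crossSquares-≤-suc c zero    = z≤n
crossSquares-≤-suc c (suc a) = +-mono-≤ (crossSquares-≤-suc c a) (*-mono-≤ (<⇒≤ (crossTime-<-suc c a)) (<⇒≤ (crossTime-<-suc c a)))

crossSquares-<-suc : ∀ c a → crossSquares c (suc a) < crossSquares (suc c) (suc a)
crossSquares-<-suc c a = +-mono-≤-< (crossSquares-≤-suc c a) (*-mono-< (crossTime-<-suc c a) (crossTime-<-suc c a))

crossTime-mono-< : ∀ {x y} → x < y → crossTime x 0 < crossTime y 0
crossTime-mono-< x<y = s≤s (+-monoˡ-< 0 (+-monoˡ-< 0 (+-mono-< x<y x<y)))

armsCost : ℕ → ℕ → ℕ → ℕ → ℕ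
armsCost x y a b = crossSquares x a + crossSquares y b

-- (x , y) ≼⟨ k ⟩ (x′ , y′) compares the minima of armsCost over splits a + b = k of the path,
-- witnessed split by split.
_≼⟨_⟩_ : ℕ × ℕ → ℕ → ℕ × ℕ → Set
(x , y) ≼⟨ k ⟩ (x′ , y′) =
  ∀ a′ b′ → a′ + b′ ≡ k → ∃₂ λ a b → a + b ≡ k × armsCost x y a b ≤ armsCost x′ y′ a′ b′

_≺⟨_⟩_ : ℕ × ℕ → ℕ → ℕ × ℕ → Set
(x , y) ≺⟨ k ⟩ (x′ , y′) =
  ∀ a′ b′ → a′ + b′ ≡ k → ∃₂ λ a b → a + b ≡ k × armsCost x y a b < armsCost x′ y′ a′ b′

≼-refl : ∀ {k p} → p ≼⟨ k ⟩ p
≼-refl a′ b′ e = a′ , b′ , e , ≤-refl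

≼-trans : ∀ {k p q s} → p ≼⟨ k ⟩ q → q ≼⟨ k ⟩ s → p ≼⟨ k ⟩ s
≼-trans p≼q q≼s a″ b″ e″ with q≼s a″ b″ e″
... | a′ , b′ , e′ , q≤s with p≼q a′ b′ e′
...   | a , b , e , p≤q = a , b , e , ≤-trans p≤q q≤s

≼-≺-trans : ∀ {k p q s} → p ≼⟨ k ⟩ q → q ≺⟨ k ⟩ s → p ≺⟨ k ⟩ s
≼-≺-trans p≼q q≺s a″ b″ e″ with q≺s a″ b″ e″
... | a′ , b′ , e′ , q<s with p≼q a′ b′ e′
...   | a , b , e , p≤q = a , b , e , ≤-<-trans p≤q q<s

≺-≼-trans : ∀ {k p q s} → p ≺⟨ k ⟩ q → q ≼⟨ k ⟩ s → p ≺⟨ k ⟩ s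
≺-≼-trans p≺q q≼s a″ b″ e″ with q≼s a″ b″ e″
... | a′ , b′ , e′ , q≤s with p≺q a′ b′ e′
...   | a , b , e , p<q = a , b , e , <-≤-trans p<q q≤s

≺⇒≼ : ∀ {k p q} → p ≺⟨ k ⟩ q → p ≼⟨ k ⟩ q
≺⇒≼ p≺q a′ b′ e′ with p≺q a′ b′ e′
... | a , b , e , p<q = a , b , e , <⇒≤ p<q

≼-swap : ∀ {k x y} → (x , y) ≼⟨ k ⟩ (y , x)
≼-swap {x = x} {y} a′ b′ e′ = b′ , a′ , trans (+-comm b′ a′) e′ , ≤-reflexive (+-comm (crossSquares x b′) _)

-- Moving a leaf from the end with more leaves, y + 1, to the end with fewer, x, replaces the
-- cost (2x + 1)² of the first edge at the x end by the larger (2y + 1)² at the y end.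
move-leaf-≺ : ∀ {k x y} → x < y → 1 ≤ k → (x , suc y) ≺⟨ k ⟩ (suc x , y)
move-leaf-≺ {k} {x} {y} x<y 1≤k a′ (suc b′) e′ = suc a′ , b′ , trans (sym (+-suc a′ b′)) e′ , (begin-strict
  crossSquares x (suc a′) + crossSquares (suc y) b′
    ≡⟨ cong (_+ crossSquares (suc y) b′) (crossSquares-cons x a′) ⟩
  crossTime x 0 * crossTime x 0 + crossSquares (suc x) a′ + crossSquares (suc y) b′
    ≡⟨ rearrange (crossTime x 0 * crossTime x 0) (crossSquares (suc x) a′) _ ⟩
  crossSquares (suc x) a′ + crossSquares (suc y) b′ + crossTime x 0 * crossTime x 0
    <⟨ +-monoʳ-< _ (*-mono-< (crossTime-mono-< x<y) (crossTime-mono-< x<y)) ⟩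
  crossSquares (suc x) a′ + crossSquares (suc y) b′ + crossTime y 0 * crossTime y 0
    ≡⟨ rearrange′ (crossSquares (suc x) a′) _ (crossTime y 0 * crossTime y 0) ⟩
  crossSquares (suc x) a′ + (crossTime y 0 * crossTime y 0 + crossSquares (suc y) b′)
    ≡⟨ cong (crossSquares (suc x) a′ +_) (crossSquares-cons y b′) ⟨
  crossSquares (suc x) a′ + crossSquares y (suc b′) ∎)
  where
  open ≤-Reasoning
  rearrange : ∀ p q s → p + q + s ≡ q + s + p
  rearrange = solve-∀
  rearrange′ : ∀ q s p → q + s + p ≡ q + (p + s)
  rearrange′ = solve-∀
move-leaf-≺ {k} {x} {y} x<y 1≤k (suc a′) zero e′ =
  suc a′ , 0 , e′ , +-monoˡ-< 0 (crossSquares-<-suc x a′)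
move-leaf-≺ {k} x<y 1≤k zero zero e′ with subst (1 ≤_) (sym e′) 1≤k
... | ()

move-leaf-≼ : ∀ {k x y} → x < y → (x , suc y) ≼⟨ k ⟩ (suc x , y)
move-leaf-≼ {zero}  x<y zero zero e′ = 0 , 0 , e′ , z≤n
move-leaf-≼ {suc k} x<y = ≺⇒≼ (move-leaf-≺ x<y (s≤s z≤n))

private
  x<d+y : ∀ {x d y} → x + suc d ≤ y → x < d + y
  x<d+y {x} {d} {y} le = ≤-trans (subst (suc x ≤_) (sym (+-suc x d)) (s≤s (m≤m+n x d))) (≤-trans le (m≤n+m y d))

move-leaves-≼ : ∀ {k} d {x y} → x + d ≤ y → (x , d + y) ≼⟨ k ⟩ (d + x , y)
move-remaining-≼ : ∀ {k} d {x y} → x + suc d ≤ y → (suc x , d + y) ≼⟨ k ⟩ (suc d + x , y)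

move-leaves-≼ zero    _  = ≼-refl
move-leaves-≼ (suc d) le = ≼-trans (move-leaf-≼ (x<d+y le)) (move-remaining-≼ d le)

move-remaining-≼ {k} d {x} {y} le =
  subst (λ z → (suc x , d + y) ≼⟨ k ⟩ (z , y)) (+-suc d x) (move-leaves-≼ d (subst (_≤ y) (+-suc x d) le))

move-leaves-≺ : ∀ {k} d {x y} → 1 ≤ k → x + suc d ≤ y → (x , suc d + y) ≺⟨ k ⟩ (suc d + x , y)
move-leaves-≺ d 1≤k le = ≺-≼-trans (move-leaf-≺ (x<d+y le) 1≤k) (move-remaining-≼ d le)

private
  balance-gap : ∀ {ℓ r ℓ₀ r₀} → ℓ ≤ r → ℓ + r ≡ ℓ₀ + r₀ → r₀ ≤ suc ℓ₀ → ∃ λ d → ℓ₀ ≡ d + ℓ × r ≡ d + r₀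
  balance-gap {ℓ} {r} {ℓ₀} {r₀} ℓ≤r e r₀≤ℓ₀+1 =
    ℓ₀ ∸ ℓ , sym (m∸n+n≡m ℓ≤ℓ₀) , +-cancelˡ-≡ ℓ r (ℓ₀ ∸ ℓ + r₀) (begin
      ℓ + r                ≡⟨ e ⟩
      ℓ₀ + r₀              ≡⟨ cong (_+ r₀) (m∸n+n≡m ℓ≤ℓ₀) ⟨
      ℓ₀ ∸ ℓ + ℓ + r₀      ≡⟨ rearrange (ℓ₀ ∸ ℓ) ℓ r₀ ⟩
      ℓ + (ℓ₀ ∸ ℓ + r₀)    ∎)
    where
    open ≡-Reasoning
    rearrange : ∀ d ℓ r₀ → d + ℓ + r₀ ≡ ℓ + (d + r₀)
    rearrange = solve-∀
    ℓ≤ℓ₀ : ℓ ≤ ℓ₀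
    ℓ≤ℓ₀ = ≮⇒≥ λ ℓ₀<ℓ → <-irrefl (sym e) (≤-<-trans (+-monoʳ-≤ ℓ₀ r₀≤ℓ₀+1)
                                   (<-≤-trans (+-mono-<-≤ ℓ₀<ℓ ℓ₀<ℓ) (+-monoʳ-≤ ℓ ℓ≤r)))

  ordered-≼ : ∀ {k ℓ r ℓ₀ r₀} → ℓ ≤ r → ℓ + r ≡ ℓ₀ + r₀ → ℓ₀ ≤ r₀ → r₀ ≤ suc ℓ₀ → (ℓ , r) ≼⟨ k ⟩ (ℓ₀ , r₀)
  ordered-≼ {ℓ = ℓ} {r₀ = r₀} ℓ≤r e ℓ₀≤r₀ r₀≤ℓ₀+1 with balance-gap ℓ≤r e r₀≤ℓ₀+1
  ... | d , refl , refl = move-leaves-≼ d (subst (_≤ r₀) (+-comm d ℓ) ℓ₀≤r₀)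

  ordered-≺ : ∀ {k ℓ r ℓ₀ r₀} → 1 ≤ k → ℓ ≢ ℓ₀ → ℓ ≤ r → ℓ + r ≡ ℓ₀ + r₀ → ℓ₀ ≤ r₀ → r₀ ≤ suc ℓ₀ →
              (ℓ , r) ≺⟨ k ⟩ (ℓ₀ , r₀)
  ordered-≺ {ℓ = ℓ} {r₀ = r₀} 1≤k ℓ≢ℓ₀ ℓ≤r e ℓ₀≤r₀ r₀≤ℓ₀+1 with balance-gap ℓ≤r e r₀≤ℓ₀+1
  ... | zero  , refl , refl = ⊥-elim (ℓ≢ℓ₀ refl)
  ... | suc d , refl , refl = move-leaves-≺ d 1≤k (subst (_≤ r₀) (+-comm (suc d) ℓ) ℓ₀≤r₀)

balanced-≼ : ∀ {k ℓ r ℓ₀ r₀} → ℓ + r ≡ ℓ₀ + r₀ → ℓ₀ ≤ r₀ → r₀ ≤ suc ℓ₀ → (ℓ , r) ≼⟨ k ⟩ (ℓ₀ , r₀)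
balanced-≼ {ℓ = ℓ} {r} e ℓ₀≤r₀ r₀≤ℓ₀+1 with ℓ ≤? r
... | yes ℓ≤r = ordered-≼ ℓ≤r e ℓ₀≤r₀ r₀≤ℓ₀+1
... | no  ℓ≰r = ≼-trans ≼-swap (ordered-≼ (<⇒≤ (≰⇒> ℓ≰r)) (trans (+-comm r ℓ) e) ℓ₀≤r₀ r₀≤ℓ₀+1)

balanced-≺ : ∀ {k ℓ r ℓ₀ r₀} → 1 ≤ k → ℓ ≢ ℓ₀ → ℓ ≢ r₀ →
             ℓ + r ≡ ℓ₀ + r₀ → ℓ₀ ≤ r₀ → r₀ ≤ suc ℓ₀ → (ℓ , r) ≺⟨ k ⟩ (ℓ₀ , r₀)
balanced-≺ {ℓ = ℓ} {r} {ℓ₀} {r₀} 1≤k ℓ≢ℓ₀ ℓ≢r₀ e ℓ₀≤r₀ r₀≤ℓ₀+1 with ℓ ≤? r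
... | yes ℓ≤r = ordered-≺ 1≤k ℓ≢ℓ₀ ℓ≤r e ℓ₀≤r₀ r₀≤ℓ₀+1
... | no  ℓ≰r = ≼-≺-trans ≼-swap (ordered-≺ 1≤k r≢ℓ₀ (<⇒≤ (≰⇒> ℓ≰r)) (trans (+-comm r ℓ) e) ℓ₀≤r₀ r₀≤ℓ₀+1)
  where
  r≢ℓ₀ : r ≢ ℓ₀
  r≢ℓ₀ refl = ℓ≢r₀ (+-cancelʳ-≡ r ℓ r₀ (trans e (+-comm r r₀)))

minUpTo-mono-≤ : ∀ k f g → (∀ a′ → a′ ≤ k → ∃ λ a → a ≤ k × f a ≤ g a′) → minUpTo k f ≤ minUpTo k g
minUpTo-mono-≤ k f g beaten with minUpTo-attained k g
... | a′ , a′≤k , min≡ with beaten a′ a′≤k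
...   | a , a≤k , fa≤ga′ = ≤-trans (minUpTo-≤ k f a≤k) (≤-trans fa≤ga′ (≤-reflexive (sym min≡)))

minUpTo-mono-< : ∀ k f g → (∀ a′ → a′ ≤ k → ∃ λ a → a ≤ k × f a < g a′) → minUpTo k f < minUpTo k g
minUpTo-mono-< k f g beaten with minUpTo-attained k g
... | a′ , a′≤k , min≡ with beaten a′ a′≤k
...   | a , a≤k , fa<ga′ = ≤-<-trans (minUpTo-≤ k f a≤k) (<-≤-trans fa<ga′ (≤-reflexive (sym min≡)))

pathJoin-split : ∀ k ℓ r a b → a + b ≡ k → pathJoin k ℓ r a ≡ (ℓ + r) + armsCost ℓ r a b
pathJoin-split _ ℓ r a b refl rewrite m+n∸m≡n a b = regroup ℓ (crossSquares ℓ a) r (crossSquares r b)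
  where
  regroup : ∀ l x r y → (l + x) + (r + y) ≡ (l + r) + (x + y)
  regroup = solve-∀

minPathJoin-balanced-≤ : ∀ k ℓ r {ℓ₀ r₀} → ℓ + r ≡ ℓ₀ + r₀ → ℓ₀ ≤ r₀ → r₀ ≤ suc ℓ₀ →
                         minUpTo k (pathJoin k ℓ r) ≤ minUpTo k (pathJoin k ℓ₀ r₀)
minPathJoin-balanced-≤ k ℓ r {ℓ₀} {r₀} e ℓ₀≤r₀ r₀≤ℓ₀+1 = minUpTo-mono-≤ k _ _ beaten
  where
  beaten : ∀ a′ → a′ ≤ k → ∃ λ a → a ≤ k × pathJoin k ℓ r a ≤ pathJoin k ℓ₀ r₀ a′
  beaten a′ a′≤k with balanced-≼ {k} e ℓ₀≤r₀ r₀≤ℓ₀+1 a′ (k ∸ a′) (m+[n∸m]≡n a′≤k)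
  ... | a , b , a+b≡k , cost≤ = a , subst (a ≤_) a+b≡k (m≤m+n a b) ,
    subst₂ _≤_ (sym (pathJoin-split k ℓ r a b a+b≡k)) (sym (pathJoin-split k ℓ₀ r₀ a′ (k ∸ a′) (m+[n∸m]≡n a′≤k)))
           (+-mono-≤ (≤-reflexive e) cost≤)

minPathJoin-balanced-< : ∀ k ℓ r {ℓ₀ r₀} → 1 ≤ k → ℓ ≢ ℓ₀ → ℓ ≢ r₀ → ℓ + r ≡ ℓ₀ + r₀ → ℓ₀ ≤ r₀ → r₀ ≤ suc ℓ₀ →
                         minUpTo k (pathJoin k ℓ r) < minUpTo k (pathJoin k ℓ₀ r₀)
minPathJoin-balanced-< k ℓ r {ℓ₀} {r₀} 1≤k ℓ≢ℓ₀ ℓ≢r₀ e ℓ₀≤r₀ r₀≤ℓ₀+1 = minUpTo-mono-< k _ _ beaten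
  where
  beaten : ∀ a′ → a′ ≤ k → ∃ λ a → a ≤ k × pathJoin k ℓ r a < pathJoin k ℓ₀ r₀ a′
  beaten a′ a′≤k with balanced-≺ 1≤k ℓ≢ℓ₀ ℓ≢r₀ e ℓ₀≤r₀ r₀≤ℓ₀+1 a′ (k ∸ a′) (m+[n∸m]≡n a′≤k)
  ... | a , b , a+b≡k , cost< = a , subst (a ≤_) a+b≡k (m≤m+n a b) ,
    subst₂ _<_ (sym (pathJoin-split k ℓ r a b a+b≡k)) (sym (pathJoin-split k ℓ₀ r₀ a′ (k ∸ a′) (m+[n∸m]≡n a′≤k)))
           (+-mono-≤-< (≤-reflexive e) cost<)

-- Isomorphisms between double brooms

Isomorphic-refl : ∀ {n} (G : Graph n) → Isomorphic G G
Isomorphic-refl G = ↔-refl , λ i j → refl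

private
  ≡ᵇ-cong-⇔ : ∀ {m n p q} → (m ≡ n → p ≡ q) → (p ≡ q → m ≡ n) → (m ≡ᵇ n) ≡ (p ≡ᵇ q)
  ≡ᵇ-cong-⇔ {m} {n} {p} {q} to from = does-⇔ (mk⇔ to from) (m ≟ n) (p ≟ q)

  reflect-succ : ∀ k i j → i ≤ k → j ≤ k → (suc i ≡ᵇ j) ≡ (suc (k ∸ j) ≡ᵇ k ∸ i)
  reflect-succ k i j i≤k j≤k = ≡ᵇ-cong-⇔ to from
    where
    to : suc i ≡ j → suc (k ∸ j) ≡ k ∸ i
    to refl = sym (+-∸-assoc 1 j≤k)
    from : suc (k ∸ j) ≡ k ∸ i → suc i ≡ j
    from e = +-cancelˡ-≡ (k ∸ j) (suc i) j (trans (+-suc (k ∸ j) i)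
               (trans (cong (_+ i) e) (trans (m∸n+n≡m i≤k) (sym (m∸n+n≡m j≤k)))))

  reflect-first : ∀ k i → i ≤ k → (i ≡ᵇ 0) ≡ (k ∸ i ≡ᵇ k)
  reflect-first k i i≤k = ≡ᵇ-cong-⇔ (λ { refl → refl })
    (λ e → +-cancelˡ-≡ k i 0 (trans (trans (cong (_+ i) (sym e)) (m∸n+n≡m i≤k)) (sym (+-identityʳ k))))

  reflect-last : ∀ k i → i ≤ k → (i ≡ᵇ k) ≡ (k ∸ i ≡ᵇ 0)
  reflect-last k i i≤k = ≡ᵇ-cong-⇔ (λ { refl → n∸n≡0 i }) (λ e → ≤-antisym i≤k (m∸n≡0⇒m≤n e))

mirrorℕ : ℕ → ℕ → ℕ → ℕ → ℕ
mirrorℕ k ℓ r j = if j ≤ᵇ k then k ∸ j else if j <ᵇ suc k + ℓ then j + r else j ∸ ℓ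

module MirrorMap (k ℓ r : ℕ) where
  open Broom k ℓ r

  μ : ℕ → ℕ
  μ = mirrorℕ k ℓ r

  μ-path : ∀ i → i ≤ k → μ i ≡ k ∸ i
  μ-path i i≤k rewrite ≤ᵇ-true i≤k = refl

  μ-left : ∀ a → a < ℓ → μ (suc k + a) ≡ suc k + r + a
  μ-left a a<ℓ rewrite ≤ᵇ-false (k<left a) | <ᵇ-true (+-monoʳ-< (suc k) a<ℓ) = swap-tail (suc k) a r
    where
    swap-tail : ∀ x a r → x + a + r ≡ x + r + a
    swap-tail = solve-∀

  μ-right : ∀ b → μ (suc k + ℓ + b) ≡ suc k + b
  μ-right b rewrite ≤ᵇ-false (k<right b) | <ᵇ-false {suc k + ℓ + b} {suc k + ℓ} (m≤m+n (suc k + ℓ) b) =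
    trans (cong (_∸ ℓ) (swap-tail (suc k) ℓ b)) (m+n∸n≡m (suc k + b) ℓ)
    where
    swap-tail : ∀ x ℓ b → x + ℓ + b ≡ x + b + ℓ
    swap-tail = solve-∀

module Mirror (k ℓ r : ℕ) where
  open Broom k ℓ r
  open MirrorMap k ℓ r
  module B′ = Broom k r ℓ
  module μ′ = MirrorMap k r ℓ

  μ-< : ∀ j → j < order → μ j < B′.order
  μ-< j j<order with vertex j j<order
  ... | path j≤k         = subst (_< B′.order) (sym (μ-path j j≤k)) (B′.path<order (m∸n≤m k j))
  ... | left a a<ℓ refl  = subst (_< B′.order) (sym (μ-left a a<ℓ)) (B′.right<order a<ℓ)
  ... | right b b<r refl = subst (_< B′.order) (sym (μ-right b)) (B′.left<order b<r)

  μ-involutive : ∀ j → j < order → mirrorℕ k r ℓ (μ j) ≡ j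
  μ-involutive j j<order with vertex j j<order
  ... | path j≤k         = trans (cong (mirrorℕ k r ℓ) (μ-path j j≤k))
                                 (trans (μ′.μ-path (k ∸ j) (m∸n≤m k j)) (m∸[m∸n]≡n j≤k))
  ... | left a a<ℓ refl  = trans (cong (mirrorℕ k r ℓ) (μ-left a a<ℓ)) (μ′.μ-right a)
  ... | right b b<r refl = trans (cong (mirrorℕ k r ℓ) (μ-right b)) (μ′.μ-left b b<r)

  μ-leaf : ∀ j → j < order → k < j → k < μ j
  μ-leaf j j<order k<j with vertex j j<order
  ... | path j≤k       = ⊥-elim (<⇒≱ k<j j≤k)
  ... | left a a<ℓ refl = subst (k <_) (sym (μ-left a a<ℓ)) (B′.k<right a)
  ... | right b _ refl  = subst (k <_) (sym (μ-right b)) (B′.k<left b)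

  μ-adj-path : ∀ i j → i ≤ k → j < order → adj i j ≡ B′.adj (μ i) (μ j)
  μ-adj-path i j i≤k j<order rewrite μ-path i i≤k with vertex j j<order
  ... | path j≤k rewrite μ-path j j≤k =
    trans (adj-path-path i j i≤k j≤k)
      (trans (cong₂ _∨_ (reflect-succ k i j i≤k j≤k) (reflect-succ k j i j≤k i≤k))
        (trans (∨-comm (suc (k ∸ j) ≡ᵇ k ∸ i) _) (sym (B′.adj-path-path (k ∸ i) (k ∸ j) (m∸n≤m k i) (m∸n≤m k j)))))
  ... | left a a<ℓ refl rewrite μ-left a a<ℓ =
    trans (adj-path-left i a a<ℓ) (trans (reflect-first k i i≤k) (sym (B′.adj-path-right (k ∸ i) a)))
  ... | right b b<r refl rewrite μ-right b =
    trans (adj-path-right i b) (trans (reflect-last k i i≤k) (sym (B′.adj-path-left (k ∸ i) b b<r)))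

  μ-adj : ∀ i j → i < order → j < order → adj i j ≡ B′.adj (μ i) (μ j)
  μ-adj i j i<order j<order with i ≤? k | j ≤? k
  ... | yes i≤k | _       = μ-adj-path i j i≤k j<order
  ... | no  _   | yes j≤k = trans (adj-sym i j) (trans (μ-adj-path j i j≤k i<order) (B′.adj-sym (μ j) (μ i)))
  ... | no  i≰k | no  j≰k = trans (adj-leaf-leaf i j (≰⇒> i≰k) (≰⇒> j≰k))
                                  (sym (B′.adj-leaf-leaf (μ i) (μ j) (μ-leaf i i<order (≰⇒> i≰k)) (μ-leaf j j<order (≰⇒> j≰k))))

  toMirror : Fin order → Fin B′.order
  toMirror u = F.fromℕ< (μ-< (toℕ u) (FP.toℕ<n u))

  toℕ-toMirror : ∀ u → toℕ (toMirror u) ≡ μ (toℕ u)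
  toℕ-toMirror u = FP.toℕ-fromℕ< _

doubleBroom-mirror : ∀ k ℓ r → Isomorphic (doubleBroom (suc (suc k)) ℓ r) (doubleBroom (suc (suc k)) r ℓ)
doubleBroom-mirror k ℓ r = mk↔ₛ′ M.toMirror M′.toMirror inverseˡ inverseʳ , preserves
  where
  module M = Mirror k ℓ r
  module M′ = Mirror k r ℓ
  inverseˡ : ∀ w → M.toMirror (M′.toMirror w) ≡ w
  inverseˡ w = FP.toℕ-injective (trans (M.toℕ-toMirror (M′.toMirror w))
                 (trans (cong (mirrorℕ k ℓ r) (M′.toℕ-toMirror w)) (M′.μ-involutive (toℕ w) (FP.toℕ<n w))))
  inverseʳ : ∀ u → M′.toMirror (M.toMirror u) ≡ u
  inverseʳ u = FP.toℕ-injective (trans (M′.toℕ-toMirror (M.toMirror u))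
                 (trans (cong (mirrorℕ k r ℓ) (M.toℕ-toMirror u)) (M.μ-involutive (toℕ u) (FP.toℕ<n u))))
  preserves : ∀ i j → doubleBroom (suc (suc k)) ℓ r i j ≡ doubleBroom (suc (suc k)) r ℓ (M.toMirror i) (M.toMirror j)
  preserves i j = trans (M.μ-adj (toℕ i) (toℕ j) (FP.toℕ<n i) (FP.toℕ<n j))
                        (sym (cong₂ (Broom.adj k r ℓ) (M.toℕ-toMirror i) (M.toℕ-toMirror j)))

adj-star : ∀ ℓ r i j → i < Broom.order 0 ℓ r → j < Broom.order 0 ℓ r → Broom.adj 0 ℓ r i j ≡ ((i ≡ᵇ 0) xor (j ≡ᵇ 0))
adj-star ℓ r zero    zero    _   _   = refl
adj-star ℓ r zero    (suc j) _   j<o with Broom.vertex 0 ℓ r (suc j) j<o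
... | Broom.path ()
... | Broom.left a a<ℓ e = trans (cong (Broom.adj 0 ℓ r 0) e) (Broom.adj-path-left 0 ℓ r 0 a a<ℓ)
... | Broom.right b _ e  = trans (cong (Broom.adj 0 ℓ r 0) e) (Broom.adj-path-right 0 ℓ r 0 b)
adj-star ℓ r (suc i) zero    i<o j<o = trans (Broom.adj-sym 0 ℓ r (suc i) 0) (adj-star ℓ r zero (suc i) j<o i<o)
adj-star ℓ r (suc i) (suc j) _   _   = Broom.adj-leaf-leaf 0 ℓ r (suc i) (suc j) z<s z<s

doubleBroom-star : ∀ {ℓ r ℓ₀ r₀} → ℓ + r ≡ ℓ₀ + r₀ → Isomorphic (doubleBroom 2 ℓ r) (doubleBroom 2 ℓ₀ r₀)
doubleBroom-star {ℓ} {r} {ℓ₀} {r₀} e =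
  mk↔ₛ′ (F.cast e′) (F.cast (sym e′)) (FP.cast-involutive e′ (sym e′)) (FP.cast-involutive (sym e′) e′) , preserves
  where
  e′ : suc (ℓ + r) ≡ suc (ℓ₀ + r₀)
  e′ = cong suc e
  preserves : ∀ i j → doubleBroom 2 ℓ r i j ≡ doubleBroom 2 ℓ₀ r₀ (F.cast e′ i) (F.cast e′ j)
  preserves i j = begin
    Broom.adj 0 ℓ r (toℕ i) (toℕ j)
      ≡⟨ adj-star ℓ r (toℕ i) (toℕ j) (FP.toℕ<n i) (FP.toℕ<n j) ⟩
    (toℕ i ≡ᵇ 0) xor (toℕ j ≡ᵇ 0)
      ≡⟨ cong₂ (λ x y → (x ≡ᵇ 0) xor (y ≡ᵇ 0)) (FP.toℕ-cast e′ i) (FP.toℕ-cast e′ j) ⟨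
    (toℕ (F.cast e′ i) ≡ᵇ 0) xor (toℕ (F.cast e′ j) ≡ᵇ 0)
      ≡⟨ adj-star ℓ₀ r₀ (toℕ (F.cast e′ i)) (toℕ (F.cast e′ j)) (FP.toℕ<n (F.cast e′ i)) (FP.toℕ<n (F.cast e′ j)) ⟨
    Broom.adj 0 ℓ₀ r₀ (toℕ (F.cast e′ i)) (toℕ (F.cast e′ j)) ∎
    where open ≡-Reasoning

module _ (k : ℕ) {ℓ r ℓ₀ r₀ : ℕ} (1≤ℓ : 1 ≤ ℓ) (1≤r : 1 ≤ r) (1≤ℓ₀ : 1 ≤ ℓ₀)
         (sum≡ : ℓ + r ≡ ℓ₀ + r₀) (ℓ₀≤r₀ : ℓ₀ ≤ r₀) (r₀≤ℓ₀+1 : r₀ ≤ suc ℓ₀)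
         {H : _} {H₀ : _} (isH : IsHittingTime (doubleBroom (suc (suc k)) ℓ r) H)
         (isH₀ : IsHittingTime (doubleBroom (suc (suc k)) ℓ₀ r₀) H₀) where

  private
    minJ≡ : minJ (doubleBroom (suc (suc k)) ℓ r) H ≡ ℕ→ℚ (minUpTo k (pathJoin k ℓ r))
    minJ≡ = minJ-doubleBroom k ℓ r 1≤ℓ 1≤r isH

    minJ₀≡ : minJ (doubleBroom (suc (suc k)) ℓ₀ r₀) H₀ ≡ ℕ→ℚ (minUpTo k (pathJoin k ℓ₀ r₀))
    minJ₀≡ = minJ-doubleBroom k ℓ₀ r₀ 1≤ℓ₀ (≤-trans 1≤ℓ₀ ℓ₀≤r₀) isH₀

  balanced-minJ-≤ : minJ (doubleBroom (suc (suc k)) ℓ r) H ≤ℚ minJ (doubleBroom (suc (suc k)) ℓ₀ r₀) H₀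
  balanced-minJ-≤ = subst₂ _≤ℚ_ (sym minJ≡) (sym minJ₀≡) (ℕ→ℚ-mono-≤ (minPathJoin-balanced-≤ k ℓ r sum≡ ℓ₀≤r₀ r₀≤ℓ₀+1))

  unbalanced-minJ-< : 1 ≤ k → ℓ ≢ ℓ₀ → ℓ ≢ r₀ →
                      minJ (doubleBroom (suc (suc k)) ℓ r) H <ℚ minJ (doubleBroom (suc (suc k)) ℓ₀ r₀) H₀
  unbalanced-minJ-< 1≤k ℓ≢ℓ₀ ℓ≢r₀ =
    subst₂ _<ℚ_ (sym minJ≡) (sym minJ₀≡) (ℕ→ℚ-mono-< (minPathJoin-balanced-< k ℓ r 1≤k ℓ≢ℓ₀ ℓ≢r₀ sum≡ ℓ₀≤r₀ r₀≤ℓ₀+1))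

  balanced-minJ-≡⇒isomorphic : minJ (doubleBroom (suc (suc k)) ℓ r) H ≡ minJ (doubleBroom (suc (suc k)) ℓ₀ r₀) H₀ →
                                Isomorphic (doubleBroom (suc (suc k)) ℓ r) (doubleBroom (suc (suc k)) ℓ₀ r₀)
  balanced-minJ-≡⇒isomorphic minJ-eq = by-cases (k ≟ 0) (ℓ ≟ ℓ₀) (ℓ ≟ r₀)
    where
    G : Graph (broomSize (suc (suc k)) ℓ r)
    G = doubleBroom (suc (suc k)) ℓ r
    by-cases : Dec (k ≡ 0) → Dec (ℓ ≡ ℓ₀) → Dec (ℓ ≡ r₀) → Isomorphic G (doubleBroom (suc (suc k)) ℓ₀ r₀)
    by-cases (yes k≡0) _ _ =
      subst (λ k′ → Isomorphic (doubleBroom (suc (suc k′)) ℓ r) (doubleBroom (suc (suc k′)) ℓ₀ r₀)) (sym k≡0)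
            (doubleBroom-star sum≡)
    by-cases (no _) (yes ℓ≡ℓ₀) _ =
      subst₂ (λ x y → Isomorphic G (doubleBroom (suc (suc k)) x y)) ℓ≡ℓ₀
             (+-cancelˡ-≡ ℓ r r₀ (trans sum≡ (cong (_+ r₀) (sym ℓ≡ℓ₀)))) (Isomorphic-refl G)
    by-cases (no _) (no _) (yes ℓ≡r₀) =
      subst₂ (λ x y → Isomorphic G (doubleBroom (suc (suc k)) x y))
             (+-cancelˡ-≡ ℓ r ℓ₀ (trans sum≡ (trans (+-comm ℓ₀ r₀) (cong (_+ ℓ₀) (sym ℓ≡r₀))))) ℓ≡r₀
             (doubleBroom-mirror k ℓ r)
    by-cases (no k≢0) (no ℓ≢ℓ₀) (no ℓ≢r₀) =
      ⊥-elim (ℚP.<-irrefl minJ-eq (unbalanced-minJ-< (n≢0⇒n>0 k≢0) ℓ≢ℓ₀ ℓ≢r₀))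

rest≡mod+half : ∀ m → m ∸ m / 2 ≡ m % 2 + m / 2
rest≡mod+half m = begin
  m ∸ m / 2                           ≡⟨ cong (_∸ m / 2) (m≡m%n+[m/n]*n m 2) ⟩
  m % 2 + m / 2 * 2 ∸ m / 2           ≡⟨ cong (_∸ m / 2) (double (m % 2) (m / 2)) ⟩
  m % 2 + m / 2 + m / 2 ∸ m / 2       ≡⟨ m+n∸n≡m (m % 2 + m / 2) (m / 2) ⟩
  m % 2 + m / 2                       ∎
  where
  open ≡-Reasoning
  double : ∀ s q → s + q * 2 ≡ s + q + q
  double = solve-∀

half≤rest : ∀ m → m / 2 ≤ m ∸ m / 2
half≤rest m = subst (m / 2 ≤_) (sym (rest≡mod+half m)) (m≤n+m (m / 2) (m % 2))

rest≤1+half : ∀ m → m ∸ m / 2 ≤ suc (m / 2)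
rest≤1+half m = subst (_≤ suc (m / 2)) (sym (rest≡mod+half m)) (+-monoˡ-≤ (m / 2) (≤-pred (m%n<n m 2)))

lemma4p3 : (n d : ℕ) → 2 ≤ d → d ≤ n ∸ 1 →
    (ℓ r : ℕ) → 1 ≤ ℓ → 1 ≤ r → ℓ + r ≡ n ∸ d + 1 →
    (H : _) → IsHittingTime (doubleBroom d ℓ r) H →
    (H₀ : _) → IsHittingTime (doubleBroom d ((n ∸ d + 1) / 2) ((n ∸ d + 1) ∸ (n ∸ d + 1) / 2)) H₀ →
    (minJ (doubleBroom d ℓ r) H ≤ℚ minJ (doubleBroom d ((n ∸ d + 1) / 2) ((n ∸ d + 1) ∸ (n ∸ d + 1) / 2)) H₀)
    × (minJ (doubleBroom d ℓ r) H ≡ minJ (doubleBroom d ((n ∸ d + 1) / 2) ((n ∸ d + 1) ∸ (n ∸ d + 1) / 2)) H₀ →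
       Isomorphic (doubleBroom d ℓ r) (doubleBroom d ((n ∸ d + 1) / 2) ((n ∸ d + 1) ∸ (n ∸ d + 1) / 2)))
lemma4p3 n (suc zero) (s≤s ()) _ _ _ _ _ _ _ _ _ _
lemma4p3 n (suc (suc k)) _ _ ℓ r 1≤ℓ 1≤r ℓ+r≡m H isH H₀ isH₀ =
  balanced-minJ-≤ k 1≤ℓ 1≤r 1≤half sum≡ (half≤rest m) (rest≤1+half m) isH isH₀ ,
  balanced-minJ-≡⇒isomorphic k 1≤ℓ 1≤r 1≤half sum≡ (half≤rest m) (rest≤1+half m) isH isH₀
  where
  m : ℕ
  m = n ∸ suc (suc k) + 1
  sum≡ : ℓ + r ≡ m / 2 + (m ∸ m / 2)
  sum≡ = trans ℓ+r≡m (sym (m+[n∸m]≡n (m/n≤m m 2)))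
  1≤half : 1 ≤ m / 2
  1≤half = m≥n⇒m/n>0 (subst (2 ≤_) ℓ+r≡m (+-mono-≤ 1≤ℓ 1≤r))
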